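{- Let $S$ be a set or multiset of positive integers, $b\in\mathbb{N}_0\cup\{\infty\}$ and $a\in\{1,2\}$. For all integers $m,n\ge0$ we have $p_{ab,S}(m,n)\ge p_{ab,S}(m+a,n)$, and $r_{ab,S}(m,n)>r_{ab,S}(m+a,n)$ provided $r_{ab,S}(m,n)\ne0$.
   Context: Each element of $S$ is assumed to have finite multiplicity. The numbers $p_{ab,S}(m,n)$ and $r_{ab,S}(m,n)$ are defined by the formal expansions $$\sum_{n\ge0}\sum_{m\in\mathbb{Z}}p_{ab,S}(m,n)z^mq^n=\prod_{\ell\in S}\frac{(1-q^{(3-a)\ell})(1-(zq^\ell)^{b+1})(1-(z^{ -1}q^\ell)^{b+1})}{(1-q^\ell)(1-zq^\ell)(1-z^{ -1}q^\ell)},$$ $$\sum_{n\ge0}\sum_{m\in\mathbb{Z}}r_{ab,S}(m,n)z^mq^n=\prod_{\ell\in S}\frac{(1-q^{(3-a)\ell})(1-(zq^\ell)^{b+1})(1-(z^{ -1}q^\ell)^{b+1})}{(1-q^\ell)^2(1-zq^\ell)(1-z^{ -1}q^\ell)},$$ where for $b=\infty$ the factors $(1-(zq^\ell)^{b+1})$, $(1-(z^{ -1}q^\ell)^{b+1})$ are interpreted as $1$. -}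

module Defs where

open import Data.Nat as ℕ using (ℕ; zero; suc; _∸_; _%_; _/_)
open import Data.Integer as ℤ using (ℤ; +_; -_; _-_; _+_; _*_)
open import Data.Bool using (Bool; true; false; if_then_else_; _∧_)
open import Relation.Nullary using (does)

data ℕ∞ : Set where
  fin : ℕ → ℕ∞
  ∞   : ℕ∞

-- A (possibly infinite) multiset S of positive integers, every element of
-- finite multiplicity: mult ℓ = multiplicity of ℓ in S (for ℓ ≥ 1; the value
-- at 0 is never used, since S consists of positive integers).
Multiset⁺ : Set
Multiset⁺ = ℕ → ℕ

-- Formal series  Σ c(m,n) z^m q^n  with m ∈ ℤ, n ∈ ℕ.
-- All series used below lie in the subring generated by q, zq, z⁻¹q,
-- i.e. c(m,n) ≠ 0 only if |m| ≤ n; multiplication is the Cauchy product,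
-- whose inner sum over z-exponents is therefore the finite range [-k,k].
Series : Set
Series = ℤ → ℕ → ℤ

sumUpTo : ℕ → (ℕ → ℤ) → ℤ
sumUpTo zero    f = f zero
sumUpTo (suc n) f = sumUpTo n f + f (suc n)

_⊛_ : Series → Series → Series
(f ⊛ g) m n =
  sumUpTo n (λ k → sumUpTo (2 ℕ.* k) (λ i →
    let j = + i - + k in f j k * g (m - j) (n ∸ k)))

one : Series
one m n = if does (m ℤ.≟ + 0) ∧ does (n ℕ.≟ 0) then + 1 else + 0

oneMinus : ℤ → ℕ → Series
oneMinus e d m n =
  one m n - (if does (m ℤ.≟ e) ∧ does (n ℕ.≟ d) then + 1 else + 0)

-- (1 - z^e q^(suc d))⁻¹ = Σ_{i ≥ 0} z^(i e) q^(i (suc d))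
geomInv : ℤ → ℕ → Series
geomInv e d m n =
  if does (n % suc d ℕ.≟ 0) ∧ does (m ℤ.≟ (+ (n / suc d)) * e)
  then + 1 else + 0

-- numerator factor (1 - (z^{±1} q^ℓ)^{b+1}), interpreted as 1 for b = ∞
zNum : ℤ → ℕ∞ → ℕ → Series
zNum s (fin b) ℓ = oneMinus (+ (suc b) * s) (suc b ℕ.* ℓ)
zNum s ∞       ℓ = one

factorP : ℕ → ℕ∞ → ℕ → Series
factorP a b ℓ' =
  (((((oneMinus (+ 0) ((3 ∸ a) ℕ.* ℓ) ⊛ zNum (+ 1) b ℓ) ⊛ zNum (- + 1) b ℓ)
     ⊛ geomInv (+ 0) ℓ') ⊛ geomInv (+ 1) ℓ') ⊛ geomInv (- + 1) ℓ')
  where ℓ = suc ℓ'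

factorR : ℕ → ℕ∞ → ℕ → Series
factorR a b ℓ' = factorP a b ℓ' ⊛ geomInv (+ 0) ℓ'

pow : Series → ℕ → Series
pow F zero    = one
pow F (suc k) = pow F k ⊛ F

prodUpTo : Multiset⁺ → (ℕ → Series) → ℕ → Series
prodUpTo S F zero     = one
prodUpTo S F (suc N)  = prodUpTo S F N ⊛ pow (F N) (S (suc N))

-- Since every factor is 1 + O(q^ℓ), the coefficient of q^n in the infinite
-- product over ℓ ∈ S equals that of the finite product over ℓ ∈ S, ℓ ≤ n.
p : ℕ → ℕ∞ → Multiset⁺ → ℤ → ℕ → ℤ
p a b S m n = prodUpTo S (factorP a b) n m n

r : ℕ → ℕ∞ → Multiset⁺ → ℤ → ℕ → ℤ
r a b S m n = prodUpTo S (factorR a b) n m n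

{-# OPTIONS --safe #-}
-- Fix n and read the coefficient of q^n as a function x of the exponent of z; call x a-unimodal if
-- it is symmetric, nonnegative and x (k + a) ≤ x k for k ≥ 0.
-- The factor of the p-product belonging to ℓ is (1 + ⋯ + q^((2-a)ℓ)) W with
-- W = Σ_{i,j≤b} (z q^ℓ)^i (z⁻¹ q^ℓ)^j. A monomial of W determines i and j, so W has 0/1 coefficients,
-- and moving (i, j) to (i - 1, j + 1), (i - 1, j) or (i, j + 1) shows that each factor is a-unimodal.
-- The extra 1/(1 - q^ℓ) of the r-product makes the decrease strict: a monomial z^k q^n lies a
-- multiple of ℓ above z^k q^(kℓ), where z^(k+a) does not occur yet.
-- Products preserve (strict) a-unimodality: for c m = Σ_j x j y (m - j),
-- 2 (c k - c (k + a)) = Σ_j (x (k - j) - x (k + a + j)) (y j - y (j + a)); the substitution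
-- j ↦ -a - j fixes each term, and for j ≥ 0 both factors are nonnegative because k + a + j exceeds
-- |k - j| + a by 2 min(k, j), a multiple of a when a ∈ {1, 2}.
module Submission where

open import Defs
open import Data.Nat using (ℕ)
open import Data.Integer using (ℤ; +_; _≤_; _<_)
open import Data.Integer as ℤ using (_+_)
open import Data.Product using (_×_)
open import Data.Sum using (_⊎_)
open import Relation.Binary.PropositionalEquality using (_≡_; _≢_)

open import Data.Bool using (if_then_else_)
open import Data.Empty using (⊥-elim)
open import Data.Integer using (_-_; _*_; -_; ∣_∣; 0ℤ; 1ℤ; -[1+_]; nonNegative)
import Data.Integer.Properties as ℤₚ
open import Algebra.Properties.CommutativeSemigroup ℤₚ.+-commutativeSemigroup using (interchange)
open import Data.Integer.Tactic.RingSolver using (solve-∀)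
open import Data.Nat using (zero; suc; z≤n; s≤s; _∸_; NonZero) renaming (_+_ to _+ₙ_; _*_ to _*ₙ_; _≤_ to _≤ₙ_; _<_ to _<ₙ_)
open import Data.Nat.DivMod using (_%_; _/_; m/n≤m; m<n⇒m/n≡0; m<n⇒m%n≡m; [m+n]%n≡m%n; m/n≡1+[m∸n]/n)
import Data.Nat.Properties as ℕₚ
import Data.Nat.Tactic.RingSolver as ℕ-Solver
open import Data.Product using (∃; _,_; proj₁; proj₂)
open import Data.Sum using (inj₁; inj₂)
open import Function using (_∘_)
open import Level using (0ℓ)
open import Relation.Binary.Bundles using (Setoid)
open import Relation.Binary.Definitions using (tri<; tri≈; tri>)
open import Relation.Binary.PropositionalEquality using (refl; sym; trans; cong; cong₂; subst; subst₂; module ≡-Reasoning)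
import Relation.Binary.Reasoning.Setoid as SetoidReasoning
open import Relation.Nullary using (¬_; yes; no; does; Dec; _×-dec_)

∑< : ℕ → (ℕ → ℤ) → ℤ
∑< zero    f = 0ℤ
∑< (suc n) f = ∑< n f + f n

sumUpTo≡∑< : ∀ n f → sumUpTo n f ≡ ∑< (suc n) f
sumUpTo≡∑< zero    f = sym (ℤₚ.+-identityˡ (f 0))
sumUpTo≡∑< (suc n) f = cong (_+ f (suc n)) (sumUpTo≡∑< n f)

∑<-cong-< : ∀ n {f g : ℕ → ℤ} → (∀ i → i <ₙ n → f i ≡ g i) → ∑< n f ≡ ∑< n g
∑<-cong-< zero    h = refl
∑<-cong-< (suc n) h = cong₂ _+_ (∑<-cong-< n (λ i i<n → h i (ℕₚ.m<n⇒m<1+n i<n))) (h n ℕₚ.≤-refl)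

∑<-cong : ∀ n {f g : ℕ → ℤ} → (∀ i → f i ≡ g i) → ∑< n f ≡ ∑< n g
∑<-cong n h = ∑<-cong-< n (λ i _ → h i)

∑<-+ : ∀ n (f g : ℕ → ℤ) → ∑< n (λ i → f i + g i) ≡ ∑< n f + ∑< n g
∑<-+ zero    f g = refl
∑<-+ (suc n) f g = trans (cong (_+ (f n + g n)) (∑<-+ n f g)) (interchange (∑< n f) (∑< n g) (f n) (g n))

∑<-neg : ∀ n (f : ℕ → ℤ) → ∑< n (λ i → - f i) ≡ - ∑< n f
∑<-neg zero    f = refl
∑<-neg (suc n) f = trans (cong (_+ (- f n)) (∑<-neg n f)) (sym (ℤₚ.neg-distrib-+ (∑< n f) (f n)))

∑<-*ˡ : ∀ n c (f : ℕ → ℤ) → ∑< n (λ i → c * f i) ≡ c * ∑< n f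
∑<-*ˡ zero    c f = sym (ℤₚ.*-zeroʳ c)
∑<-*ˡ (suc n) c f = trans (cong (_+ (c * f n)) (∑<-*ˡ n c f)) (sym (ℤₚ.*-distribˡ-+ c (∑< n f) (f n)))

∑<-*ʳ : ∀ n c (f : ℕ → ℤ) → ∑< n (λ i → f i * c) ≡ ∑< n f * c
∑<-*ʳ zero    c f = sym (ℤₚ.*-zeroˡ c)
∑<-*ʳ (suc n) c f = trans (cong (_+ (f n * c)) (∑<-*ʳ n c f)) (sym (ℤₚ.*-distribʳ-+ c (∑< n f) (f n)))

∑<-zero : ∀ n {f : ℕ → ℤ} → (∀ i → i <ₙ n → f i ≡ 0ℤ) → ∑< n f ≡ 0ℤ
∑<-zero zero    h = refl
∑<-zero (suc n) h = cong₂ _+_ (∑<-zero n (λ i i<n → h i (ℕₚ.m<n⇒m<1+n i<n))) (h n ℕₚ.≤-refl)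

∑<-comm : ∀ n m (f : ℕ → ℕ → ℤ) → ∑< n (λ i → ∑< m (f i)) ≡ ∑< m (λ j → ∑< n (λ i → f i j))
∑<-comm zero    m f = sym (∑<-zero m (λ _ _ → refl))
∑<-comm (suc n) m f = trans (cong (_+ ∑< m (f n)) (∑<-comm n m f)) (sym (∑<-+ m (λ j → ∑< n (λ i → f i j)) (f n)))

∑<-sucˡ : ∀ n (f : ℕ → ℤ) → ∑< (suc n) f ≡ f 0 + ∑< n (λ i → f (suc i))
∑<-sucˡ zero    f = trans (ℤₚ.+-identityˡ (f 0)) (sym (ℤₚ.+-identityʳ (f 0)))
∑<-sucˡ (suc n) f = trans (cong (_+ f (suc n)) (∑<-sucˡ n f)) (ℤₚ.+-assoc (f 0) _ _)

∑<-reverse : ∀ n (f : ℕ → ℤ) → ∑< n f ≡ ∑< n (λ i → f (n ∸ suc i))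
∑<-reverse zero    f = refl
∑<-reverse (suc n) f = sym (begin
  ∑< (suc n) (λ i → f (n ∸ i))      ≡⟨ ∑<-sucˡ n (λ i → f (n ∸ i)) ⟩
  f n + ∑< n (λ i → f (n ∸ suc i))  ≡⟨ cong (λ s → f n + s) (∑<-reverse n f) ⟨
  f n + ∑< n f                      ≡⟨ ℤₚ.+-comm (f n) (∑< n f) ⟩
  ∑< n f + f n                      ∎)
  where open ≡-Reasoning

∑<-single : ∀ n d (f : ℕ → ℤ) → d <ₙ n → (∀ i → i ≢ d → f i ≡ 0ℤ) → ∑< n f ≡ f d
∑<-single (suc n) d f d<n f≡0 with n ℕₚ.≟ d
... | yes refl = trans (cong (_+ f n) (∑<-zero n (λ i i<n → f≡0 i (λ i≡n → ℕₚ.<-irrefl i≡n i<n)))) (ℤₚ.+-identityˡ (f n))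
... | no n≢d   = trans (cong₂ _+_ (∑<-single n d f d<n′ f≡0) (f≡0 n n≢d)) (ℤₚ.+-identityʳ (f d))
  where d<n′ = ℕₚ.≤∧≢⇒< (ℕₚ.≤-pred d<n) (λ d≡n → n≢d (sym d≡n))

∑<-triangle : ∀ n (F : ℕ → ℕ → ℤ) →
  ∑< (suc n) (λ k → ∑< (suc k) (λ i → F i k)) ≡ ∑< (suc n) (λ i → ∑< (suc (n ∸ i)) (λ l → F i (i +ₙ l)))
∑<-triangle zero    F = refl
∑<-triangle (suc n) F = begin
  ∑< (suc n) (λ k → ∑< (suc k) (λ i → F i k)) + (∑< (suc n) (λ i → F i (suc n)) + F (suc n) (suc n))
    ≡⟨ cong (_+ (∑< (suc n) (λ i → F i (suc n)) + F (suc n) (suc n))) (∑<-triangle n F) ⟩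
  Rows n + (∑< (suc n) (λ i → F i (suc n)) + F (suc n) (suc n))
    ≡⟨ ℤₚ.+-assoc (Rows n) _ _ ⟨
  (Rows n + ∑< (suc n) (λ i → F i (suc n))) + F (suc n) (suc n)
    ≡⟨ cong (_+ F (suc n) (suc n)) (∑<-+ (suc n) _ _) ⟨
  ∑< (suc n) (λ i → ∑< (suc (n ∸ i)) (λ l → F i (i +ₙ l)) + F i (suc n)) + F (suc n) (suc n)
    ≡⟨ cong₂ _+_ (∑<-cong-< (suc n) extendRow) lastRow ⟩
  Rows (suc n) ∎
  where
  open ≡-Reasoning
  Rows : ℕ → ℤ
  Rows n = ∑< (suc n) (λ i → ∑< (suc (n ∸ i)) (λ l → F i (i +ₙ l)))
  extendRow : ∀ i → i <ₙ suc n →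
    ∑< (suc (n ∸ i)) (λ l → F i (i +ₙ l)) + F i (suc n) ≡ ∑< (suc (suc n ∸ i)) (λ l → F i (i +ₙ l))
  extendRow i i<sn = trans (cong (λ x → ∑< (suc (n ∸ i)) (λ l → F i (i +ₙ l)) + F i x) (sym i+[sn∸i]≡sn))
                           (cong (λ x → ∑< (suc x) (λ l → F i (i +ₙ l))) (sym (ℕₚ.+-∸-assoc 1 i≤n)))
    where
    i≤n = ℕₚ.≤-pred i<sn
    i+[sn∸i]≡sn : i +ₙ suc (n ∸ i) ≡ suc n
    i+[sn∸i]≡sn = trans (ℕₚ.+-suc i (n ∸ i)) (cong suc (ℕₚ.m+[n∸m]≡n i≤n))
  lastRow : F (suc n) (suc n) ≡ ∑< (suc (suc n ∸ suc n)) (λ l → F (suc n) (suc n +ₙ l))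
  lastRow = sym (trans (cong (λ x → ∑< (suc x) (λ l → F (suc n) (suc n +ₙ l))) (ℕₚ.n∸n≡0 n))
                       (trans (ℤₚ.+-identityˡ _) (cong (F (suc n)) (ℕₚ.+-identityʳ (suc n)))))

∑<-mono-≤ : ∀ n {f g : ℕ → ℤ} → (∀ i → i <ₙ n → f i ≤ g i) → ∑< n f ≤ ∑< n g
∑<-mono-≤ zero    h = ℤₚ.≤-refl
∑<-mono-≤ (suc n) h = ℤₚ.+-mono-≤ (∑<-mono-≤ n (λ i i<n → h i (ℕₚ.m<n⇒m<1+n i<n))) (h n ℕₚ.≤-refl)

∑<-mono-< : ∀ n {f g : ℕ → ℤ} → (∀ i → i <ₙ n → f i ≤ g i) → ∀ k → k <ₙ n → f k < g k → ∑< n f < ∑< n g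
∑<-mono-< (suc n) f≤g k k<n fk<gk with k ℕₚ.≟ n
... | yes refl = ℤₚ.+-mono-≤-< (∑<-mono-≤ n (λ i i<n → f≤g i (ℕₚ.m<n⇒m<1+n i<n))) fk<gk
... | no k≢n   = ℤₚ.+-mono-<-≤ (∑<-mono-< n (λ i i<n → f≤g i (ℕₚ.m<n⇒m<1+n i<n)) k k<n′ fk<gk) (f≤g n ℕₚ.≤-refl)
  where k<n′ = ℕₚ.≤∧≢⇒< (ℕₚ.≤-pred k<n) k≢n

∑<-nonneg : ∀ n {f : ℕ → ℤ} → (∀ i → i <ₙ n → 0ℤ ≤ f i) → 0ℤ ≤ ∑< n f
∑<-nonneg n h = subst (_≤ ∑< n _) (∑<-zero n (λ _ _ → refl)) (∑<-mono-≤ n h)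

term≤∑< : ∀ n {f : ℕ → ℤ} → (∀ i → i <ₙ n → 0ℤ ≤ f i) → ∀ k → k <ₙ n → f k ≤ ∑< n f
term≤∑< (suc n) {f} h k k<n with k ℕₚ.≟ n
... | yes refl = ℤₚ.i≤j+i (f k) (∑< n f) {{nonNegative (∑<-nonneg n (λ i i<n → h i (ℕₚ.m<n⇒m<1+n i<n)))}}
... | no k≢n   = ℤₚ.≤-trans (term≤∑< n (λ i i<n → h i (ℕₚ.m<n⇒m<1+n i<n)) k k<n′)
                              (ℤₚ.i≤i+j (∑< n f) (f n) {{nonNegative (h n ℕₚ.≤-refl)}})
  where k<n′ = ℕₚ.≤∧≢⇒< (ℕₚ.≤-pred k<n) k≢n

∑<-nonzero : ∀ n (f : ℕ → ℤ) → ∑< n f ≢ 0ℤ → ∃ λ k → k <ₙ n × f k ≢ 0ℤ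
∑<-nonzero zero    f ∑≢0 = ⊥-elim (∑≢0 refl)
∑<-nonzero (suc n) f ∑≢0 with f n ℤₚ.≟ 0ℤ
... | no fn≢0  = n , ℕₚ.≤-refl , fn≢0
... | yes fn≡0 with ∑<-nonzero n f (λ ∑≡0 → ∑≢0 (cong₂ _+_ ∑≡0 fn≡0))
...   | k , k<n , fk≢0 = k , ℕₚ.m<n⇒m<1+n k<n , fk≢0

-- The sum of φ j over -N ≤ j < N (note the asymmetric range).
∑± : ℕ → (ℤ → ℤ) → ℤ
∑± N φ = ∑< N (λ t → φ (+ t)) + ∑< N (λ t → φ -[1+ t ])

VanishesBeyond : ℕ → (ℤ → ℤ) → Set
VanishesBeyond K φ = ∀ j → K <ₙ ∣ j ∣ → φ j ≡ 0ℤ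

VanishesBeyond-mono : ∀ {K L φ} → K ≤ₙ L → VanishesBeyond K φ → VanishesBeyond L φ
VanishesBeyond-mono K≤L φ≡0 j L<j = φ≡0 j (ℕₚ.≤-<-trans K≤L L<j)

VanishesBeyond-shift : ∀ K φ c → VanishesBeyond K φ → VanishesBeyond (K +ₙ ∣ c ∣) (λ j → φ (j + c))
VanishesBeyond-shift K φ c φ≡0 j K+c<j = φ≡0 (j + c) (ℕₚ.≰⇒> (λ j+c≤K → ℕₚ.<⇒≱ K+c<j (ℕₚ.≤-trans ∣j∣≤ (ℕₚ.+-monoˡ-≤ ∣ c ∣ j+c≤K))))
  where
  ∣j∣≤ : ∣ j ∣ ≤ₙ ∣ j + c ∣ +ₙ ∣ c ∣
  ∣j∣≤ = subst (λ i → ∣ i ∣ ≤ₙ ∣ j + c ∣ +ₙ ∣ c ∣) (j+c-c≡j j c) (ℤₚ.∣i-j∣≤∣i∣+∣j∣ (j + c) c)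
    where j+c-c≡j : ∀ j c → j + c - c ≡ j
          j+c-c≡j = solve-∀

VanishesBeyond-neg : ∀ K φ → VanishesBeyond K φ → VanishesBeyond K (λ j → φ (- j))
VanishesBeyond-neg K φ φ≡0 j K<j = φ≡0 (- j) (subst (K <ₙ_) (sym (ℤₚ.∣-i∣≡∣i∣ j)) K<j)

VanishesBeyond-*ʳ : ∀ K φ (ψ : ℤ → ℤ) → VanishesBeyond K φ → VanishesBeyond K (λ j → φ j * ψ j)
VanishesBeyond-*ʳ K φ ψ φ≡0 j K<j = trans (cong (_* ψ j) (φ≡0 j K<j)) (ℤₚ.*-zeroˡ (ψ j))

VanishesBeyond-*ˡ : ∀ K φ (ψ : ℤ → ℤ) → VanishesBeyond K φ → VanishesBeyond K (λ j → ψ j * φ j)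
VanishesBeyond-*ˡ K φ ψ φ≡0 j K<j = trans (cong (ψ j *_) (φ≡0 j K<j)) (ℤₚ.*-zeroʳ (ψ j))

VanishesBeyond-reflect-shift : ∀ K φ c → VanishesBeyond K φ → VanishesBeyond (K +ₙ ∣ c ∣) (λ j → φ (c - j))
VanishesBeyond-reflect-shift K φ c φ≡0 j lt =
  trans (cong φ (c-j≡-[j-c] c j))
        (VanishesBeyond-shift K (φ ∘ -_) (- c) (VanishesBeyond-neg K φ φ≡0) j (subst (λ n → K +ₙ n <ₙ ∣ j ∣) (sym (ℤₚ.∣-i∣≡∣i∣ c)) lt))
  where c-j≡-[j-c] : ∀ c j → c - j ≡ - (j - c)
        c-j≡-[j-c] = solve-∀

∑±-cong-≤ : ∀ N {φ ψ : ℤ → ℤ} → (∀ j → ∣ j ∣ ≤ₙ N → φ j ≡ ψ j) → ∑± N φ ≡ ∑± N ψ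
∑±-cong-≤ N h = cong₂ _+_ (∑<-cong-< N (λ t t<N → h (+ t) (ℕₚ.<⇒≤ t<N))) (∑<-cong-< N (λ t t<N → h -[1+ t ] t<N))

∑±-cong : ∀ N {φ ψ : ℤ → ℤ} → (∀ j → φ j ≡ ψ j) → ∑± N φ ≡ ∑± N ψ
∑±-cong N h = ∑±-cong-≤ N (λ j _ → h j)

∑±-+ : ∀ N (φ ψ : ℤ → ℤ) → ∑± N (λ j → φ j + ψ j) ≡ ∑± N φ + ∑± N ψ
∑±-+ N φ ψ = trans (cong₂ _+_ (∑<-+ N (φ ∘ +_) (ψ ∘ +_)) (∑<-+ N (φ ∘ -[1+_]) (ψ ∘ -[1+_])))
                   (interchange (∑< N (φ ∘ +_)) (∑< N (ψ ∘ +_)) (∑< N (φ ∘ -[1+_])) (∑< N (ψ ∘ -[1+_])))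

∑±-neg : ∀ N (φ : ℤ → ℤ) → ∑± N (λ j → - φ j) ≡ - ∑± N φ
∑±-neg N φ = trans (cong₂ _+_ (∑<-neg N (φ ∘ +_)) (∑<-neg N (φ ∘ -[1+_]))) (sym (ℤₚ.neg-distrib-+ (∑< N (φ ∘ +_)) _))

∑±-- : ∀ N (φ ψ : ℤ → ℤ) → ∑± N (λ j → φ j - ψ j) ≡ ∑± N φ - ∑± N ψ
∑±-- N φ ψ = trans (∑±-+ N φ (λ j → - ψ j)) (cong (λ s → ∑± N φ + s) (∑±-neg N ψ))

∑±-*ˡ : ∀ N c (φ : ℤ → ℤ) → ∑± N (λ j → c * φ j) ≡ c * ∑± N φ
∑±-*ˡ N c φ = trans (cong₂ _+_ (∑<-*ˡ N c (φ ∘ +_)) (∑<-*ˡ N c (φ ∘ -[1+_]))) (sym (ℤₚ.*-distribˡ-+ c (∑< N (φ ∘ +_)) _))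

∑±-*ʳ : ∀ N c (φ : ℤ → ℤ) → ∑± N (λ j → φ j * c) ≡ ∑± N φ * c
∑±-*ʳ N c φ = trans (cong₂ _+_ (∑<-*ʳ N c (φ ∘ +_)) (∑<-*ʳ N c (φ ∘ -[1+_]))) (sym (ℤₚ.*-distribʳ-+ c (∑< N (φ ∘ +_)) _))

∑±-∑<-comm : ∀ N n (φ : ℤ → ℕ → ℤ) → ∑± N (λ j → ∑< n (φ j)) ≡ ∑< n (λ k → ∑± N (λ j → φ j k))
∑±-∑<-comm N n φ = trans (cong₂ _+_ (∑<-comm N n (φ ∘ +_)) (∑<-comm N n (φ ∘ -[1+_])))
                         (sym (∑<-+ n (λ k → ∑< N (λ t → φ (+ t) k)) (λ k → ∑< N (λ t → φ -[1+ t ] k))))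

∑±-comm : ∀ N M (φ : ℤ → ℤ → ℤ) → ∑± N (λ i → ∑± M (φ i)) ≡ ∑± M (λ j → ∑± N (λ i → φ i j))
∑±-comm N M φ = trans (∑±-+ N (λ i → ∑< M (φ i ∘ +_)) (λ i → ∑< M (φ i ∘ -[1+_])))
                      (cong₂ _+_ (∑±-∑<-comm N M (λ i → φ i ∘ +_)) (∑±-∑<-comm N M (λ i → φ i ∘ -[1+_])))

∑±-zero : ∀ N {φ : ℤ → ℤ} → (∀ j → φ j ≡ 0ℤ) → ∑± N φ ≡ 0ℤ
∑±-zero N h = cong₂ _+_ (∑<-zero N (λ _ _ → h _)) (∑<-zero N (λ _ _ → h _))

∑±-nonneg : ∀ N {φ : ℤ → ℤ} → (∀ j → 0ℤ ≤ φ j) → 0ℤ ≤ ∑± N φ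
∑±-nonneg N h = ℤₚ.+-mono-≤ (∑<-nonneg N (λ _ _ → h _)) (∑<-nonneg N (λ _ _ → h _))

term≤∑± : ∀ N {φ : ℤ → ℤ} → (∀ j → 0ℤ ≤ φ j) → ∀ t → t <ₙ N → φ (+ t) ≤ ∑± N φ
term≤∑± N {φ} φ≥0 t t<N = ℤₚ.≤-trans (term≤∑< N (λ _ _ → φ≥0 _) t t<N)
                                      (ℤₚ.i≤i+j _ (∑< N (φ ∘ -[1+_])) {{nonNegative (∑<-nonneg N (λ _ _ → φ≥0 _))}})

∑±-nonzero : ∀ N (φ : ℤ → ℤ) → ∑± N φ ≢ 0ℤ → ∃ λ j → φ j ≢ 0ℤ
∑±-nonzero N φ ∑≢0 with ∑< N (λ t → φ (+ t)) ℤₚ.≟ 0ℤ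
... | no ∑⁺≢0  = let (t , _ , φt≢0) = ∑<-nonzero N _ ∑⁺≢0 in + t , φt≢0
... | yes ∑⁺≡0 = let (t , _ , φt≢0) = ∑<-nonzero N _ (λ ∑⁻≡0 → ∑≢0 (cong₂ _+_ ∑⁺≡0 ∑⁻≡0)) in -[1+ t ] , φt≢0

∑±-single : ∀ N (φ : ℤ → ℤ) e → ∣ e ∣ <ₙ N → (∀ j → j ≢ e → φ j ≡ 0ℤ) → ∑± N φ ≡ φ e
∑±-single N φ (+ t) t<N φ≡0 =
  trans (cong₂ _+_ (∑<-single N t _ t<N (λ i i≢t → φ≡0 (+ i) (λ eq → i≢t (ℤₚ.+-injective eq))))
                   (∑<-zero N (λ i _ → φ≡0 -[1+ i ] (λ ()))))
        (ℤₚ.+-identityʳ (φ (+ t)))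
∑±-single N φ -[1+ t ] t<N φ≡0 =
  trans (cong₂ _+_ (∑<-zero N (λ i _ → φ≡0 (+ i) (λ ())))
                   (∑<-single N t _ (ℕₚ.<-trans (ℕₚ.n<1+n t) t<N) (λ i i≢t → φ≡0 -[1+ i ] (λ eq → i≢t (ℤₚ.-[1+-injective eq)))))
        (ℤₚ.+-identityˡ (φ -[1+ t ]))

∑±-suc : ∀ N φ → ∑± (suc N) φ ≡ ∑± N φ + (φ (+ N) + φ -[1+ N ])
∑±-suc N φ = interchange (∑< N (φ ∘ +_)) (φ (+ N)) (∑< N (φ ∘ -[1+_])) (φ -[1+ N ])

∑±-widen : ∀ K φ → VanishesBeyond K φ → ∀ N d → K <ₙ N → ∑± (N +ₙ d) φ ≡ ∑± N φ
∑±-widen K φ φ≡0 N zero    K<N = cong (λ x → ∑± x φ) (ℕₚ.+-identityʳ N)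
∑±-widen K φ φ≡0 N (suc d) K<N = begin
  ∑± (N +ₙ suc d) φ                                      ≡⟨ cong (λ x → ∑± x φ) (ℕₚ.+-suc N d) ⟩
  ∑± (suc (N +ₙ d)) φ                                    ≡⟨ ∑±-suc (N +ₙ d) φ ⟩
  ∑± (N +ₙ d) φ + (φ (+ (N +ₙ d)) + φ -[1+ (N +ₙ d) ])  ≡⟨ cong₂ (λ s x → s + (x + φ -[1+ (N +ₙ d) ])) (∑±-widen K φ φ≡0 N d K<N) (φ≡0 _ K<N+d) ⟩
  ∑± N φ + (0ℤ + φ -[1+ (N +ₙ d) ])                      ≡⟨ cong (λ x → ∑± N φ + (0ℤ + x)) (φ≡0 _ (ℕₚ.m<n⇒m<1+n K<N+d)) ⟩
  ∑± N φ + 0ℤ                                            ≡⟨ ℤₚ.+-identityʳ _ ⟩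
  ∑± N φ                                                 ∎
  where
  open ≡-Reasoning
  K<N+d = ℕₚ.<-≤-trans K<N (ℕₚ.m≤m+n N d)

∑±-range-irrelevant : ∀ K φ → VanishesBeyond K φ → ∀ N M → K <ₙ N → K <ₙ M → ∑± N φ ≡ ∑± M φ
∑±-range-irrelevant K φ φ≡0 N M K<N K<M =
  trans (sym (∑±-widen K φ φ≡0 N M K<N)) (trans (cong (λ x → ∑± x φ) (ℕₚ.+-comm N M)) (∑±-widen K φ φ≡0 M N K<M))

-- Translating by one and reflecting both turn the window [-N-1, N+1) into (-N-1, N+1].
private
  window-slide : ∀ N (φ : ℤ → ℤ) →
    ∑< (suc N) (λ t → φ (+ suc t)) + ∑< (suc N) (λ t → φ (- + t)) + φ -[1+ N ] ≡ ∑± (suc N) φ + φ (+ suc N)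
  window-slide N φ = begin
    ∑< (suc N) (φ ∘ +_ ∘ suc) + ∑< (suc N) (λ t → φ (- + t)) + φ -[1+ N ]
      ≡⟨ cong (λ s → ∑< (suc N) (φ ∘ +_ ∘ suc) + s + φ -[1+ N ]) (∑<-sucˡ N (λ t → φ (- + t))) ⟩
    ∑< (suc N) (φ ∘ +_ ∘ suc) + (φ (+ 0) + ∑< N (φ ∘ -[1+_])) + φ -[1+ N ]
      ≡⟨ regroup (∑< (suc N) (φ ∘ +_ ∘ suc)) (φ (+ 0)) (∑< N (φ ∘ -[1+_])) (φ -[1+ N ]) ⟩
    (φ (+ 0) + ∑< (suc N) (φ ∘ +_ ∘ suc)) + (∑< N (φ ∘ -[1+_]) + φ -[1+ N ])
      ≡⟨ cong (_+ ∑< (suc N) (φ ∘ -[1+_])) (∑<-sucˡ (suc N) (φ ∘ +_)) ⟨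
    ∑< (suc N) (φ ∘ +_) + φ (+ suc N) + ∑< (suc N) (φ ∘ -[1+_])
      ≡⟨ ℤₚ.+-assoc (∑< (suc N) (φ ∘ +_)) _ _ ⟩
    ∑< (suc N) (φ ∘ +_) + (φ (+ suc N) + ∑< (suc N) (φ ∘ -[1+_]))
      ≡⟨ cong (λ s → ∑< (suc N) (φ ∘ +_) + s) (ℤₚ.+-comm (φ (+ suc N)) _) ⟩
    ∑< (suc N) (φ ∘ +_) + (∑< (suc N) (φ ∘ -[1+_]) + φ (+ suc N))
      ≡⟨ ℤₚ.+-assoc (∑< (suc N) (φ ∘ +_)) _ _ ⟨
    ∑± (suc N) φ + φ (+ suc N) ∎
    where
    open ≡-Reasoning
    regroup : ∀ a b c d → a + (b + c) + d ≡ (b + a) + (c + d)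
    regroup = solve-∀

∑±-shift₁-boundary : ∀ N (φ : ℤ → ℤ) → ∑± (suc N) (λ j → φ (j + 1ℤ)) + φ -[1+ N ] ≡ ∑± (suc N) φ + φ (+ suc N)
∑±-shift₁-boundary N φ =
  trans (cong (λ s → s + φ -[1+ N ]) (cong₂ _+_ (∑<-cong (suc N) (λ t → cong (φ ∘ +_) (ℕₚ.+-comm t 1)))
                                               (∑<-cong (suc N) (λ t → cong φ (-[1+t]+1 t)))))
        (window-slide N φ)
  where
  -[1+t]+1 : ∀ t → -[1+ t ] + 1ℤ ≡ - + t
  -[1+t]+1 zero    = refl
  -[1+t]+1 (suc t) = refl

∑±-reflect-boundary : ∀ N (φ : ℤ → ℤ) → ∑± (suc N) (λ j → φ (- j)) + φ -[1+ N ] ≡ ∑± (suc N) φ + φ (+ suc N)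
∑±-reflect-boundary N φ = trans (cong (_+ φ -[1+ N ]) (ℤₚ.+-comm (∑< (suc N) (λ t → φ (- + t))) _)) (window-slide N φ)

private
  drop-zero-terms : ∀ {A B x y : ℤ} → x ≡ 0ℤ → y ≡ 0ℤ → A + x ≡ B + y → A ≡ B
  drop-zero-terms {A} {B} refl refl eq = trans (sym (ℤₚ.+-identityʳ A)) (trans eq (ℤₚ.+-identityʳ B))

∑±-shift₁ : ∀ K φ → VanishesBeyond K φ → ∀ N → K <ₙ N → ∑± N (λ j → φ (j + 1ℤ)) ≡ ∑± N φ
∑±-shift₁ K φ φ≡0 (suc N) K<N = drop-zero-terms (φ≡0 _ K<N) (φ≡0 _ K<N) (∑±-shift₁-boundary N φ)

∑±-reflect : ∀ K φ → VanishesBeyond K φ → ∀ N → K <ₙ N → ∑± N (λ j → φ (- j)) ≡ ∑± N φ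
∑±-reflect K φ φ≡0 (suc N) K<N = drop-zero-terms (φ≡0 _ K<N) (φ≡0 _ K<N) (∑±-reflect-boundary N φ)

∑±-shift⁺ : ∀ k K φ → VanishesBeyond K φ → ∀ N → K +ₙ k <ₙ N → ∑± N (λ j → φ (j + + k)) ≡ ∑± N φ
∑±-shift⁺ zero    K φ φ≡0 N _  = ∑±-cong N (λ j → cong φ (ℤₚ.+-identityʳ j))
∑±-shift⁺ (suc k) K φ φ≡0 N lt = begin
  ∑± N (λ j → φ (j + + suc k))    ≡⟨ ∑±-cong N (λ j → cong φ (shift-split j (+ k))) ⟩
  ∑± N (λ j → φ (j + 1ℤ + + k))   ≡⟨ ∑±-shift₁ (K +ₙ k) (λ j → φ (j + + k)) (VanishesBeyond-shift K φ (+ k) φ≡0) N lt′ ⟩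
  ∑± N (λ j → φ (j + + k))        ≡⟨ ∑±-shift⁺ k K φ φ≡0 N lt′ ⟩
  ∑± N φ                          ∎
  where
  open ≡-Reasoning
  shift-split : ∀ j x → j + (1ℤ + x) ≡ j + 1ℤ + x
  shift-split = solve-∀
  lt′ : K +ₙ k <ₙ N
  lt′ = ℕₚ.<-trans (ℕₚ.+-monoʳ-< K (ℕₚ.n<1+n k)) lt

∑±-shift : ∀ K φ → VanishesBeyond K φ → ∀ c N → K +ₙ ∣ c ∣ <ₙ N → ∑± N (λ j → φ (j + c)) ≡ ∑± N φ
∑±-shift K φ φ≡0 (+ k)      N lt = ∑±-shift⁺ k K φ φ≡0 N lt
∑±-shift K φ φ≡0 -[1+ k ] N lt = begin
  ∑± N (λ j → φ (j + -[1+ k ]))     ≡⟨ ∑±-cong N (λ j → cong φ (j-c≡-[-j+c] j (+ suc k))) ⟩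
  ∑± N (λ j → φ⁻ (- j + + suc k))   ≡⟨ ∑±-reflect (K +ₙ suc k) (λ j → φ⁻ (j + + suc k)) (VanishesBeyond-shift K φ⁻ (+ suc k) φ⁻≡0) N lt ⟩
  ∑± N (λ j → φ⁻ (j + + suc k))     ≡⟨ ∑±-shift⁺ (suc k) K φ⁻ φ⁻≡0 N lt ⟩
  ∑± N φ⁻                           ≡⟨ ∑±-reflect K φ φ≡0 N (ℕₚ.≤-<-trans (ℕₚ.m≤m+n K (suc k)) lt) ⟩
  ∑± N φ                            ∎
  where
  open ≡-Reasoning
  φ⁻ : ℤ → ℤ
  φ⁻ j = φ (- j)
  φ⁻≡0 = VanishesBeyond-neg K φ φ≡0
  j-c≡-[-j+c] : ∀ j c → j + - c ≡ - (- j + c)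
  j-c≡-[-j+c] = solve-∀

∑±-reflect-shift : ∀ K φ → VanishesBeyond K φ → ∀ c N → K +ₙ ∣ c ∣ <ₙ N → ∑± N (λ j → φ (c - j)) ≡ ∑± N φ
∑±-reflect-shift K φ φ≡0 c N lt = begin
  ∑± N (λ j → φ (c - j))     ≡⟨ ∑±-cong N (λ j → cong φ (ℤₚ.+-comm c (- j))) ⟩
  ∑± N (λ j → φ (- j + c))   ≡⟨ ∑±-reflect (K +ₙ ∣ c ∣) (λ i → φ (i + c)) (VanishesBeyond-shift K φ c φ≡0) N lt ⟩
  ∑± N (λ j → φ (j + c))     ≡⟨ ∑±-shift K φ φ≡0 c N lt ⟩
  ∑± N φ                     ∎
  where open ≡-Reasoning

[q^_]_ : ℕ → Series → ℤ → ℤ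
([q^ n ] f) m = f m n

-- ⊛ only sums over |j| ≤ k at q-degree k, so it is the Cauchy product only on admissible series.
Admissible : Series → Set
Admissible f = ∀ n → VanishesBeyond n ([q^ n ] f)

convolve : ℕ → (ℤ → ℤ) → (ℤ → ℤ) → ℤ → ℤ
convolve N x y m = ∑± N (λ j → x j * y (m - j))

private
  +[a+b]-b≡a : ∀ a b → + (a +ₙ b) - + b ≡ + a
  +[a+b]-b≡a a b = trans (cong (_- + b) (ℤₚ.pos-+ a b)) (x+y-y≡x (+ a) (+ b))
    where x+y-y≡x : ∀ x y → x + y - y ≡ x
          x+y-y≡x = solve-∀

sumUpTo-centred : ∀ k (φ : ℤ → ℤ) → sumUpTo (2 *ₙ k) (λ i → φ (+ i - + k)) + φ -[1+ k ] ≡ ∑± (suc k) φ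
sumUpTo-centred zero    φ = cong₂ _+_ (sym (ℤₚ.+-identityˡ (φ (+ 0)))) (sym (ℤₚ.+-identityˡ (φ -[1+ 0 ])))
sumUpTo-centred (suc k) φ = begin
  sumUpTo (2 *ₙ suc k) ψ + φ -[1+ suc k ]
    ≡⟨ cong (λ x → sumUpTo x ψ + φ -[1+ suc k ]) (ℕₚ.*-suc 2 k) ⟩
  sumUpTo (suc (2 *ₙ k)) ψ + ψ (suc (suc (2 *ₙ k))) + φ -[1+ suc k ]
    ≡⟨ cong₂ (λ x y → x + y + φ -[1+ suc k ]) peel ψ-last ⟩
  ψ 0 + sumUpTo (2 *ₙ k) (ψ ∘ suc) + φ (+ suc k) + φ -[1+ suc k ]
    ≡⟨ cong (λ x → ψ 0 + x + φ (+ suc k) + φ -[1+ suc k ]) (sumUpTo-cong (2 *ₙ k) (λ i → cong φ (+[1+i]-+[1+k] i))) ⟩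
  φ -[1+ k ] + S + φ (+ suc k) + φ -[1+ suc k ]
    ≡⟨ regroup (φ -[1+ k ]) S (φ (+ suc k)) (φ -[1+ suc k ]) ⟩
  S + φ -[1+ k ] + (φ (+ suc k) + φ -[1+ suc k ])
    ≡⟨ cong (_+ (φ (+ suc k) + φ -[1+ suc k ])) (sumUpTo-centred k φ) ⟩
  ∑± (suc k) φ + (φ (+ suc k) + φ -[1+ suc k ])
    ≡⟨ ∑±-suc (suc k) φ ⟨
  ∑± (suc (suc k)) φ ∎
  where
  open ≡-Reasoning
  ψ : ℕ → ℤ
  ψ i = φ (+ i - + suc k)
  S = sumUpTo (2 *ₙ k) (λ i → φ (+ i - + k))
  sumUpTo-cong : ∀ n {f g : ℕ → ℤ} → (∀ i → f i ≡ g i) → sumUpTo n f ≡ sumUpTo n g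
  sumUpTo-cong n {f} {g} f≡g = trans (sumUpTo≡∑< n f) (trans (∑<-cong (suc n) f≡g) (sym (sumUpTo≡∑< n g)))
  peel : sumUpTo (suc (2 *ₙ k)) ψ ≡ ψ 0 + sumUpTo (2 *ₙ k) (ψ ∘ suc)
  peel = trans (sumUpTo≡∑< (suc (2 *ₙ k)) ψ)
               (trans (∑<-sucˡ (suc (2 *ₙ k)) ψ) (cong (λ s → ψ 0 + s) (sym (sumUpTo≡∑< (2 *ₙ k) (ψ ∘ suc)))))
  2+2k≡[1+k]+[1+k] : ∀ k → suc (suc (2 *ₙ k)) ≡ suc k +ₙ suc k
  2+2k≡[1+k]+[1+k] = ℕ-Solver.solve-∀
  ψ-last : ψ (suc (suc (2 *ₙ k))) ≡ φ (+ suc k)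
  ψ-last = cong φ (trans (cong (λ x → + x - + suc k) (2+2k≡[1+k]+[1+k] k)) (+[a+b]-b≡a (suc k) (suc k)))
  +[1+i]-+[1+k] : ∀ i → + suc i - + suc k ≡ + i - + k
  +[1+i]-+[1+k] i = trans (ℤₚ.m-n≡m⊖n (suc i) (suc k)) (trans (ℤₚ.[1+m]⊖[1+n]≡m⊖n i k) (sym (ℤₚ.m-n≡m⊖n i k)))
  regroup : ∀ (a s b c : ℤ) → a + s + b + c ≡ s + a + (b + c)
  regroup = solve-∀

⊛-coeff : ∀ f g → Admissible f → ∀ m n N → n <ₙ N →
  (f ⊛ g) m n ≡ ∑< (suc n) (λ k → convolve N ([q^ k ] f) ([q^ (n ∸ k) ] g) m)
⊛-coeff f g f-adm m n N n<N = trans (sumUpTo≡∑< n _) (∑<-cong-< (suc n) level)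
  where
  level : ∀ k → k <ₙ suc n →
    sumUpTo (2 *ₙ k) (λ i → f (+ i - + k) k * g (m - (+ i - + k)) (n ∸ k)) ≡ convolve N ([q^ k ] f) ([q^ (n ∸ k) ] g) m
  level k k<sn = begin
    sumUpTo (2 *ₙ k) (λ i → φ (+ i - + k))             ≡⟨ ℤₚ.+-identityʳ _ ⟨
    sumUpTo (2 *ₙ k) (λ i → φ (+ i - + k)) + 0ℤ        ≡⟨ cong (λ x → sumUpTo (2 *ₙ k) (λ i → φ (+ i - + k)) + x) (φ≡0 -[1+ k ] ℕₚ.≤-refl) ⟨
    sumUpTo (2 *ₙ k) (λ i → φ (+ i - + k)) + φ -[1+ k ] ≡⟨ sumUpTo-centred k φ ⟩
    ∑± (suc k) φ                                       ≡⟨ ∑±-range-irrelevant k φ φ≡0 (suc k) N ℕₚ.≤-refl (ℕₚ.<-≤-trans k<sn n<N) ⟩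
    ∑± N φ                                             ∎
    where
    open ≡-Reasoning
    φ : ℤ → ℤ
    φ j = f j k * g (m - j) (n ∸ k)
    φ≡0 : VanishesBeyond k φ
    φ≡0 = VanishesBeyond-*ʳ k ([q^ k ] f) (λ j → g (m - j) (n ∸ k)) (f-adm k)

∣m∣≤∣m-j∣+∣j∣ : ∀ m j → ∣ m ∣ ≤ₙ ∣ m - j ∣ +ₙ ∣ j ∣
∣m∣≤∣m-j∣+∣j∣ m j = subst (λ i → ∣ i ∣ ≤ₙ ∣ m - j ∣ +ₙ ∣ j ∣) (m-j+j≡m m j) (ℤₚ.∣i+j∣≤∣i∣+∣j∣ (m - j) j)
  where m-j+j≡m : ∀ m j → m - j + j ≡ m
        m-j+j≡m = solve-∀

⊛-admissible : ∀ f g → Admissible f → Admissible g → Admissible (f ⊛ g)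
⊛-admissible f g f-adm g-adm n m n<∣m∣ =
  trans (⊛-coeff f g f-adm m n (suc n) ℕₚ.≤-refl)
        (∑<-zero (suc n) (λ k k<sn → ∑±-zero (suc n) (λ j → term≡0 k (ℕₚ.≤-pred k<sn) j)))
  where
  term≡0 : ∀ k → k ≤ₙ n → ∀ j → f j k * g (m - j) (n ∸ k) ≡ 0ℤ
  term≡0 k k≤n j with k ℕₚ.<? ∣ j ∣
  ... | yes k<∣j∣ = trans (cong (_* g (m - j) (n ∸ k)) (f-adm k j k<∣j∣)) (ℤₚ.*-zeroˡ (g (m - j) (n ∸ k)))
  ... | no  k≮∣j∣ = trans (cong (f j k *_) (g-adm (n ∸ k) (m - j) n∸k<∣m-j∣)) (ℤₚ.*-zeroʳ (f j k))
    where
    n∸k<∣m-j∣ : n ∸ k <ₙ ∣ m - j ∣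
    n∸k<∣m-j∣ = ℕₚ.≰⇒> (λ ∣m-j∣≤n∸k → ℕₚ.<⇒≱ n<∣m∣ (ℕₚ.≤-trans (∣m∣≤∣m-j∣+∣j∣ m j)
      (subst (∣ m - j ∣ +ₙ ∣ j ∣ ≤ₙ_) (ℕₚ.m∸n+n≡m k≤n) (ℕₚ.+-mono-≤ ∣m-j∣≤n∸k (ℕₚ.≮⇒≥ k≮∣j∣)))))

convolve-comm : ∀ K x y → VanishesBeyond K x → VanishesBeyond K y → ∀ m N → K +ₙ ∣ m ∣ <ₙ N →
  convolve N x y m ≡ convolve N y x m
convolve-comm K x y x≡0 y≡0 m N lt = begin
  ∑± N (λ j → x j * y (m - j))             ≡⟨ ∑±-cong N (λ j → trans (ℤₚ.*-comm (x j) (y (m - j))) (cong (λ i → y (m - j) * x i) (sym (m-[m-j]≡j m j)))) ⟩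
  ∑± N (λ j → y (m - j) * x (m - (m - j))) ≡⟨ ∑±-reflect-shift K (λ j → y j * x (m - j)) (VanishesBeyond-*ʳ K y _ y≡0) m N lt ⟩
  ∑± N (λ j → y j * x (m - j))             ∎
  where
  open ≡-Reasoning
  m-[m-j]≡j : ∀ m j → m - (m - j) ≡ j
  m-[m-j]≡j = solve-∀

⊛-comm : ∀ f g → Admissible f → Admissible g → ∀ m n → (f ⊛ g) m n ≡ (g ⊛ f) m n
⊛-comm f g f-adm g-adm m n = begin
  (f ⊛ g) m n                                                         ≡⟨ ⊛-coeff f g f-adm m n N n<N ⟩
  ∑< (suc n) (λ k → convolve N ([q^ k ] f) ([q^ (n ∸ k) ] g) m)       ≡⟨ ∑<-reverse (suc n) _ ⟩
  ∑< (suc n) (λ k → convolve N ([q^ (n ∸ k) ] f) ([q^ (n ∸ (n ∸ k)) ] g) m) ≡⟨ ∑<-cong-< (suc n) swap ⟩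
  ∑< (suc n) (λ k → convolve N ([q^ k ] g) ([q^ (n ∸ k) ] f) m)       ≡⟨ ⊛-coeff g f g-adm m n N n<N ⟨
  (g ⊛ f) m n                                                         ∎
  where
  open ≡-Reasoning
  N = suc (n +ₙ ∣ m ∣)
  n<N : n <ₙ N
  n<N = s≤s (ℕₚ.m≤m+n n ∣ m ∣)
  swap : ∀ k → k <ₙ suc n →
    convolve N ([q^ (n ∸ k) ] f) ([q^ (n ∸ (n ∸ k)) ] g) m ≡ convolve N ([q^ k ] g) ([q^ (n ∸ k) ] f) m
  swap k k<sn = trans (cong (λ i → convolve N ([q^ (n ∸ k) ] f) ([q^ i ] g) m) (ℕₚ.m∸[m∸n]≡n k≤n))
                      (convolve-comm n _ _ (VanishesBeyond-mono (ℕₚ.m∸n≤m n k) (f-adm (n ∸ k)))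
                                           (VanishesBeyond-mono k≤n (g-adm k)) m N ℕₚ.≤-refl)
    where k≤n = ℕₚ.≤-pred k<sn

-- Both bracketings expand to Σ_{k′+k″≤n} Σ_{j′,j″} f j′ k′ * g j″ k″ * h (m-j′-j″) (n-k′-k″).
private
  module Associativity (f g h : Series) (f-adm : Admissible f) (g-adm : Admissible g) (m : ℤ) (n : ℕ) where
    open ≡-Reasoning
    M = suc n
    N = suc (n +ₙ (M +ₙ M))

    expanded : ℕ → ℕ → ℤ
    expanded k′ k″ = ∑± M (λ j′ → ∑± N (λ j″ → f j′ k′ * (g j″ k″ * h (m - j′ - j″) (n ∸ k′ ∸ k″))))

    byOuterDegree : ℕ → ℕ → ℤ
    byOuterDegree k′ k = ∑± M (λ j′ → ∑± N (λ j → f j′ k′ * g (j - j′) (k ∸ k′) * h (m - j) (n ∸ k)))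

    expand-inner-left : ∀ k → k <ₙ suc n →
      convolve N ([q^ k ] (f ⊛ g)) ([q^ (n ∸ k) ] h) m ≡ ∑< (suc k) (λ k′ → byOuterDegree k′ k)
    expand-inner-left k k<sn = begin
      ∑± N (λ j → (f ⊛ g) j k * H j)
        ≡⟨ ∑±-cong N (λ j → cong (_* H j) (⊛-coeff f g f-adm j k M k<sn)) ⟩
      ∑± N (λ j → ∑< (suc k) (λ k′ → F j k′) * H j)
        ≡⟨ ∑±-cong N (λ j → ∑<-*ʳ (suc k) (H j) (F j)) ⟨
      ∑± N (λ j → ∑< (suc k) (λ k′ → F j k′ * H j))
        ≡⟨ ∑±-∑<-comm N (suc k) (λ j k′ → F j k′ * H j) ⟩
      ∑< (suc k) (λ k′ → ∑± N (λ j → F j k′ * H j))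
        ≡⟨ ∑<-cong (suc k) (λ k′ → trans (∑±-cong N (λ j → sym (∑±-*ʳ M (H j) (λ j′ → f j′ k′ * g (j - j′) (k ∸ k′)))))
                                          (∑±-comm N M (λ j j′ → f j′ k′ * g (j - j′) (k ∸ k′) * H j))) ⟩
      ∑< (suc k) (λ k′ → byOuterDegree k′ k) ∎
      where
      H : ℤ → ℤ
      H j = h (m - j) (n ∸ k)
      F : ℤ → ℕ → ℤ
      F j k′ = convolve M ([q^ k′ ] f) ([q^ (k ∸ k′) ] g) j

    reindex-left : ∀ k′ k″ → k′ ≤ₙ n → k″ ≤ₙ n ∸ k′ → byOuterDegree k′ (k′ +ₙ k″) ≡ expanded k′ k″
    reindex-left k′ k″ k′≤n k″≤n∸k′ = ∑±-cong-≤ M (λ j′ ∣j′∣≤M → begin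
      ∑± N (λ j → f j′ k′ * g (j - j′) ((k′ +ₙ k″) ∸ k′) * h (m - j) (n ∸ (k′ +ₙ k″)))
        ≡⟨ ∑±-cong N (λ j → cong₂ (λ x y → f j′ k′ * g (j - j′) x * h (m - j) y) (ℕₚ.m+n∸m≡n k′ k″) (sym (ℕₚ.∸-+-assoc n k′ k″))) ⟩
      ∑± N (ψ j′)
        ≡⟨ ∑±-shift (n +ₙ M) (ψ j′) (ψ≡0 j′ ∣j′∣≤M) j′ N (lt j′ ∣j′∣≤M) ⟨
      ∑± N (λ j″ → ψ j′ (j″ + j′))
        ≡⟨ ∑±-cong N (λ j″ → regroup j′ j″) ⟩
      ∑± N (λ j″ → f j′ k′ * (g j″ k″ * h (m - j′ - j″) (n ∸ k′ ∸ k″))) ∎)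
      where
      ψ : ℤ → ℤ → ℤ
      ψ j′ j = f j′ k′ * g (j - j′) k″ * h (m - j) (n ∸ k′ ∸ k″)
      a+b-b≡a : ∀ a b → a + b - b ≡ a
      a+b-b≡a = solve-∀
      m-[a+b]≡m-b-a : ∀ m a b → m - (a + b) ≡ m - b - a
      m-[a+b]≡m-b-a = solve-∀
      regroup : ∀ j′ j″ → ψ j′ (j″ + j′) ≡ f j′ k′ * (g j″ k″ * h (m - j′ - j″) (n ∸ k′ ∸ k″))
      regroup j′ j″ = trans (cong₂ (λ x y → f j′ k′ * g x k″ * h y (n ∸ k′ ∸ k″)) (a+b-b≡a j″ j′) (m-[a+b]≡m-b-a m j″ j′))
                             (ℤₚ.*-assoc (f j′ k′) (g j″ k″) _)
      ψ≡0 : ∀ j′ → ∣ j′ ∣ ≤ₙ M → VanishesBeyond (n +ₙ M) (ψ j′)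
      ψ≡0 j′ ∣j′∣≤M = VanishesBeyond-*ʳ (n +ₙ M) _ (λ j → h (m - j) (n ∸ k′ ∸ k″)) (VanishesBeyond-*ˡ (n +ₙ M) _ (λ _ → f j′ k′)
        (VanishesBeyond-mono (ℕₚ.+-mono-≤ (ℕₚ.≤-trans k″≤n∸k′ (ℕₚ.m∸n≤m n k′)) (subst (_≤ₙ M) (sym (ℤₚ.∣-i∣≡∣i∣ j′)) ∣j′∣≤M))
          (VanishesBeyond-shift k″ ([q^ k″ ] g) (- j′) (g-adm k″))))
      lt : ∀ j′ → ∣ j′ ∣ ≤ₙ M → n +ₙ M +ₙ ∣ j′ ∣ <ₙ N
      lt j′ ∣j′∣≤M = s≤s (subst (n +ₙ M +ₙ ∣ j′ ∣ ≤ₙ_) (ℕₚ.+-assoc n M M) (ℕₚ.+-monoʳ-≤ (n +ₙ M) ∣j′∣≤M))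

    left : ((f ⊛ g) ⊛ h) m n ≡ ∑< (suc n) (λ k′ → ∑< (suc (n ∸ k′)) (expanded k′))
    left = begin
      ((f ⊛ g) ⊛ h) m n                                                      ≡⟨ ⊛-coeff (f ⊛ g) h (⊛-admissible f g f-adm g-adm) m n N n<N ⟩
      ∑< (suc n) (λ k → convolve N ([q^ k ] (f ⊛ g)) ([q^ (n ∸ k) ] h) m)    ≡⟨ ∑<-cong-< (suc n) expand-inner-left ⟩
      ∑< (suc n) (λ k → ∑< (suc k) (λ k′ → byOuterDegree k′ k))              ≡⟨ ∑<-triangle n byOuterDegree ⟩
      ∑< (suc n) (λ k′ → ∑< (suc (n ∸ k′)) (λ k″ → byOuterDegree k′ (k′ +ₙ k″))) ≡⟨ ∑<-cong-< (suc n) (λ k′ k′<sn →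
                                                                                   ∑<-cong-< (suc (n ∸ k′)) (λ k″ k″<s →
                                                                                     reindex-left k′ k″ (ℕₚ.≤-pred k′<sn) (ℕₚ.≤-pred k″<s))) ⟩
      ∑< (suc n) (λ k′ → ∑< (suc (n ∸ k′)) (expanded k′))                    ∎
      where n<N = s≤s (ℕₚ.m≤m+n n (M +ₙ M))

    right : (f ⊛ (g ⊛ h)) m n ≡ ∑< (suc n) (λ k′ → ∑< (suc (n ∸ k′)) (expanded k′))
    right = trans (⊛-coeff f (g ⊛ h) f-adm m n M ℕₚ.≤-refl) (∑<-cong (suc n) expand-inner-right)
      where
      expand-inner-right : ∀ k′ → convolve M ([q^ k′ ] f) ([q^ (n ∸ k′) ] (g ⊛ h)) m ≡ ∑< (suc (n ∸ k′)) (expanded k′)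
      expand-inner-right k′ = begin
        ∑± M (λ j′ → f j′ k′ * (g ⊛ h) (m - j′) (n ∸ k′))
          ≡⟨ ∑±-cong M (λ j′ → cong (f j′ k′ *_) (⊛-coeff g h g-adm (m - j′) (n ∸ k′) N n∸k′<N)) ⟩
        ∑± M (λ j′ → f j′ k′ * ∑< (suc (n ∸ k′)) (G j′))
          ≡⟨ ∑±-cong M (λ j′ → trans (sym (∑<-*ˡ (suc (n ∸ k′)) (f j′ k′) (G j′)))
                                     (∑<-cong (suc (n ∸ k′)) (λ k″ → sym (∑±-*ˡ N (f j′ k′) (λ j″ → g j″ k″ * h (m - j′ - j″) (n ∸ k′ ∸ k″)))))) ⟩
        ∑± M (λ j′ → ∑< (suc (n ∸ k′)) (λ k″ → ∑± N (λ j″ → f j′ k′ * (g j″ k″ * h (m - j′ - j″) (n ∸ k′ ∸ k″)))))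
          ≡⟨ ∑±-∑<-comm M (suc (n ∸ k′)) (λ j′ k″ → ∑± N (λ j″ → f j′ k′ * (g j″ k″ * h (m - j′ - j″) (n ∸ k′ ∸ k″)))) ⟩
        ∑< (suc (n ∸ k′)) (expanded k′) ∎
        where
        G : ℤ → ℕ → ℤ
        G j′ k″ = convolve N ([q^ k″ ] g) ([q^ (n ∸ k′ ∸ k″) ] h) (m - j′)
        n∸k′<N = ℕₚ.≤-<-trans (ℕₚ.m∸n≤m n k′) (s≤s (ℕₚ.m≤m+n n (M +ₙ M)))

⊛-assoc : ∀ f g h → Admissible f → Admissible g → ∀ m n → ((f ⊛ g) ⊛ h) m n ≡ (f ⊛ (g ⊛ h)) m n
⊛-assoc f g h f-adm g-adm m n = trans left (sym right)
  where open Associativity f g h f-adm g-adm m n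

_≈_ : Series → Series → Set
f ≈ g = ∀ m n → f m n ≡ g m n

_≈[_]_ : Series → ℕ → Series → Set
f ≈[ n ] g = ∀ m k → k ≤ₙ n → f m k ≡ g m k

≈⇒≈[] : ∀ {f g} n → f ≈ g → f ≈[ n ] g
≈⇒≈[] n f≈g m k _ = f≈g m k

≈[]-trans : ∀ {f g h} n → f ≈[ n ] g → g ≈[ n ] h → f ≈[ n ] h
≈[]-trans n f≈g g≈h m k k≤n = trans (f≈g m k k≤n) (g≈h m k k≤n)

≈-trans : ∀ {f g h} → f ≈ g → g ≈ h → f ≈ h
≈-trans f≈g g≈h m n = trans (f≈g m n) (g≈h m n)

≈-sym : ∀ {f g} → f ≈ g → g ≈ f
≈-sym f≈g m n = sym (f≈g m n)

private
  sumUpTo-cong-≤ : ∀ n {f g : ℕ → ℤ} → (∀ i → i ≤ₙ n → f i ≡ g i) → sumUpTo n f ≡ sumUpTo n g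
  sumUpTo-cong-≤ n {f} {g} f≡g =
    trans (sumUpTo≡∑< n f) (trans (∑<-cong-< (suc n) (λ i i<sn → f≡g i (ℕₚ.≤-pred i<sn))) (sym (sumUpTo≡∑< n g)))

⊛-cong-≤ : ∀ {f f′ g g′} n → f ≈[ n ] f′ → g ≈[ n ] g′ → (f ⊛ g) ≈[ n ] (f′ ⊛ g′)
⊛-cong-≤ n f≈f′ g≈g′ m k k≤n = sumUpTo-cong-≤ k (λ i i≤k → sumUpTo-cong-≤ (2 *ₙ i) (λ t _ →
  cong₂ _*_ (f≈f′ _ _ (ℕₚ.≤-trans i≤k k≤n)) (g≈g′ _ _ (ℕₚ.≤-trans (ℕₚ.m∸n≤m k i) k≤n))))

⊛-cong : ∀ {f f′ g g′} → f ≈ f′ → g ≈ g′ → (f ⊛ g) ≈ (f′ ⊛ g′)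
⊛-cong f≈f′ g≈g′ m n = ⊛-cong-≤ n (≈⇒≈[] n f≈f′) (≈⇒≈[] n g≈g′) m n ℕₚ.≤-refl

≈-setoid : Setoid 0ℓ 0ℓ
≈-setoid = record
  { Carrier       = Series
  ; _≈_           = _≈_
  ; isEquivalence = record { refl = λ _ _ → refl ; sym = ≈-sym ; trans = ≈-trans }
  }

⊛-swapʳ : ∀ f g h → Admissible f → Admissible g → Admissible h → ((f ⊛ g) ⊛ h) ≈ ((f ⊛ h) ⊛ g)
⊛-swapʳ f g h f-adm g-adm h-adm = begin
  (f ⊛ g) ⊛ h   ≈⟨ ⊛-assoc f g h f-adm g-adm ⟩
  f ⊛ (g ⊛ h)   ≈⟨ ⊛-cong {f} (λ _ _ → refl) (⊛-comm g h g-adm h-adm) ⟩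
  f ⊛ (h ⊛ g)   ≈⟨ ⊛-assoc f h g f-adm h-adm ⟨
  (f ⊛ h) ⊛ g   ∎
  where open SetoidReasoning ≈-setoid

⊛-pair-up : ∀ A B C D E F → Admissible A → Admissible B → Admissible C → Admissible D → Admissible E → Admissible F →
  (((((A ⊛ B) ⊛ C) ⊛ D) ⊛ E) ⊛ F) ≈ ((A ⊛ D) ⊛ ((B ⊛ E) ⊛ (C ⊛ F)))
⊛-pair-up A B C D E F aA aB aC aD aE aF = begin
  ((((A ⊛ B) ⊛ C) ⊛ D) ⊛ E) ⊛ F   ≈⟨ ⊛-congˡ F (⊛-congˡ E (⊛-swapʳ (A ⊛ B) C D aAB aC aD)) ⟩
  ((((A ⊛ B) ⊛ D) ⊛ C) ⊛ E) ⊛ F   ≈⟨ ⊛-congˡ F (⊛-congˡ E (⊛-congˡ C (⊛-swapʳ A B D aA aB aD))) ⟩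
  ((((A ⊛ D) ⊛ B) ⊛ C) ⊛ E) ⊛ F   ≈⟨ ⊛-congˡ F (⊛-swapʳ ((A ⊛ D) ⊛ B) C E aADB aC aE) ⟩
  ((((A ⊛ D) ⊛ B) ⊛ E) ⊛ C) ⊛ F   ≈⟨ ⊛-assoc (((A ⊛ D) ⊛ B) ⊛ E) C F (⊛-admissible ((A ⊛ D) ⊛ B) E aADB aE) aC ⟩
  (((A ⊛ D) ⊛ B) ⊛ E) ⊛ (C ⊛ F)   ≈⟨ ⊛-congˡ (C ⊛ F) (⊛-assoc (A ⊛ D) B E aAD aB) ⟩
  ((A ⊛ D) ⊛ (B ⊛ E)) ⊛ (C ⊛ F)   ≈⟨ ⊛-assoc (A ⊛ D) (B ⊛ E) (C ⊛ F) aAD (⊛-admissible B E aB aE) ⟩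
  (A ⊛ D) ⊛ ((B ⊛ E) ⊛ (C ⊛ F))   ∎
  where
  open SetoidReasoning ≈-setoid
  aAB  = ⊛-admissible A B aA aB
  aAD  = ⊛-admissible A D aA aD
  aADB = ⊛-admissible (A ⊛ D) B aAD aB
  ⊛-congˡ : ∀ {f f′} g → f ≈ f′ → (f ⊛ g) ≈ (f′ ⊛ g)
  ⊛-congˡ {f} {f′} g f≈f′ = ⊛-cong {f} {f′} {g} {g} f≈f′ (λ _ _ → refl)

_⊕_ : Series → Series → Series
(f ⊕ g) m n = f m n + g m n

_⊝_ : Series → Series → Series
(f ⊝ g) m n = f m n - g m n

∑ˢ : ℕ → (ℕ → Series) → Series
∑ˢ B F m n = ∑< B (λ i → F i m n)

private
  sumUpTo-distrib : ∀ n (_∙_ : ℤ → ℤ → ℤ) (a b : ℕ → ℤ) → (∀ N (a b : ℕ → ℤ) → ∑< N (λ i → a i ∙ b i) ≡ ∑< N a ∙ ∑< N b) →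
    sumUpTo n (λ i → a i ∙ b i) ≡ sumUpTo n a ∙ sumUpTo n b
  sumUpTo-distrib n _∙_ a b ∑<-distrib =
    trans (sumUpTo≡∑< n _) (trans (∑<-distrib (suc n) a b) (sym (cong₂ _∙_ (sumUpTo≡∑< n a) (sumUpTo≡∑< n b))))

  ∑<-- : ∀ N (a b : ℕ → ℤ) → ∑< N (λ i → a i - b i) ≡ ∑< N a - ∑< N b
  ∑<-- N a b = trans (∑<-+ N a (λ i → - b i)) (cong (λ s → ∑< N a + s) (∑<-neg N b))

  sumUpTo-∑<-comm : ∀ n B (a : ℕ → ℕ → ℤ) → sumUpTo n (λ i → ∑< B (a i)) ≡ ∑< B (λ b → sumUpTo n (λ i → a i b))
  sumUpTo-∑<-comm n B a = trans (sumUpTo≡∑< n _) (trans (∑<-comm (suc n) B a) (∑<-cong B (λ b → sym (sumUpTo≡∑< n (λ i → a i b)))))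

⊛-distribʳ-⊝ : ∀ f g h → ((f ⊝ g) ⊛ h) ≈ ((f ⊛ h) ⊝ (g ⊛ h))
⊛-distribʳ-⊝ f g h m n =
  trans (sumUpTo-cong-≤ n (λ k _ → trans (sumUpTo-cong-≤ (2 *ₙ k) (λ i _ → [a-b]*c≡a*c-b*c (f _ k) _ _))
                                         (sumUpTo-distrib (2 *ₙ k) _-_ _ _ ∑<--)))
        (sumUpTo-distrib n _-_ _ _ ∑<--)
  where [a-b]*c≡a*c-b*c : ∀ (a b c : ℤ) → (a - b) * c ≡ a * c - b * c
        [a-b]*c≡a*c-b*c = solve-∀

⊛-distribʳ-∑ˢ : ∀ B F h → (∑ˢ B F ⊛ h) ≈ ∑ˢ B (λ i → F i ⊛ h)
⊛-distribʳ-∑ˢ B F h m n =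
  trans (sumUpTo-cong-≤ n (λ k _ → trans (sumUpTo-cong-≤ (2 *ₙ k) (λ i _ → sym (∑<-*ʳ B _ (λ b → F b _ k))))
                                         (sumUpTo-∑<-comm (2 *ₙ k) B _)))
        (sumUpTo-∑<-comm n B _)

𝟙 : ∀ {P : Set} → Dec P → ℤ
𝟙 P? = if does P? then 1ℤ else 0ℤ

module _ {P : Set} where

  𝟙-yes : (P? : Dec P) → P → 𝟙 P? ≡ 1ℤ
  𝟙-yes (yes _) _ = refl
  𝟙-yes (no ¬p) p = ⊥-elim (¬p p)

  𝟙-no : (P? : Dec P) → ¬ P → 𝟙 P? ≡ 0ℤ
  𝟙-no (yes p) ¬p = ⊥-elim (¬p p)
  𝟙-no (no _)  _  = refl

  𝟙≢0⇒ : (P? : Dec P) → 𝟙 P? ≢ 0ℤ → P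
  𝟙≢0⇒ (yes p) _   = p
  𝟙≢0⇒ (no _)  1≢0 = ⊥-elim (1≢0 refl)

  𝟙-nonneg : (P? : Dec P) → 0ℤ ≤ 𝟙 P?
  𝟙-nonneg (yes _) = ℤ.+≤+ z≤n
  𝟙-nonneg (no _)  = ℤₚ.≤-refl

  𝟙-cong : ∀ {Q : Set} (P? : Dec P) (Q? : Dec Q) → (P → Q) → (Q → P) → 𝟙 P? ≡ 𝟙 Q?
  𝟙-cong (yes _) (yes _) _   _   = refl
  𝟙-cong (no _)  (no _)  _   _   = refl
  𝟙-cong (yes p) (no ¬q) P→Q _   = ⊥-elim (¬q (P→Q p))
  𝟙-cong (no ¬p) (yes q) _   Q→P = ⊥-elim (¬p (Q→P q))

-- The monomial z^e q^d; one = δ (+ 0) 0 and oneMinus e d = one ⊝ δ e d hold by definition.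
δ : ℤ → ℕ → Series
δ e d m n = 𝟙 ((m ℤₚ.≟ e) ×-dec (n ℕₚ.≟ d))

δ-admissible : ∀ e d → ∣ e ∣ ≤ₙ d → Admissible (δ e d)
δ-admissible e d ∣e∣≤d n m n<∣m∣ = 𝟙-no ((m ℤₚ.≟ e) ×-dec (n ℕₚ.≟ d)) (λ { (refl , refl) → ℕₚ.<⇒≱ n<∣m∣ ∣e∣≤d })

shift : ℤ → ℕ → Series → Series
shift e d X m n = 𝟙 (d ℕₚ.≤? n) * X (m - e) (n ∸ d)

shift-≤ : ∀ e d X m n → d ≤ₙ n → shift e d X m n ≡ X (m - e) (n ∸ d)
shift-≤ e d X m n d≤n = trans (cong (_* X (m - e) (n ∸ d)) (𝟙-yes (d ℕₚ.≤? n) d≤n)) (ℤₚ.*-identityˡ (X (m - e) (n ∸ d)))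

shift-≰ : ∀ e d X m n → ¬ d ≤ₙ n → shift e d X m n ≡ 0ℤ
shift-≰ e d X m n d≰n = trans (cong (_* X (m - e) (n ∸ d)) (𝟙-no (d ℕₚ.≤? n) d≰n)) (ℤₚ.*-zeroˡ (X (m - e) (n ∸ d)))

shift-cong : ∀ e d {X Y} → X ≈ Y → shift e d X ≈ shift e d Y
shift-cong e d X≈Y m n = cong (𝟙 (d ℕₚ.≤? n) *_) (X≈Y (m - e) (n ∸ d))

shift-⊕ : ∀ e d X Y → shift e d (X ⊕ Y) ≈ (shift e d X ⊕ shift e d Y)
shift-⊕ e d X Y m n = ℤₚ.*-distribˡ-+ (𝟙 (d ℕₚ.≤? n)) _ _

shift-∑ˢ : ∀ e d B F → shift e d (∑ˢ B F) ≈ ∑ˢ B (λ i → shift e d (F i))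
shift-∑ˢ e d B F m n = sym (∑<-*ˡ B (𝟙 (d ℕₚ.≤? n)) (λ i → F i (m - e) (n ∸ d)))

shift-shift : ∀ e d e′ d′ X → shift e d (shift e′ d′ X) ≈ shift (e + e′) (d +ₙ d′) X
shift-shift e d e′ d′ X m n = by-cases (d ℕₚ.≤? n) (d′ ℕₚ.≤? (n ∸ d))
  where
  m-[e+e′]≡m-e-e′ : ∀ m e e′ → m - (e + e′) ≡ m - e - e′
  m-[e+e′]≡m-e-e′ = solve-∀
  by-cases : Dec (d ≤ₙ n) → Dec (d′ ≤ₙ n ∸ d) → shift e d (shift e′ d′ X) m n ≡ shift (e + e′) (d +ₙ d′) X m n
  by-cases (no d≰n) _ = trans (shift-≰ e d (shift e′ d′ X) m n d≰n)
    (sym (shift-≰ (e + e′) (d +ₙ d′) X m n (λ d+d′≤n → d≰n (ℕₚ.≤-trans (ℕₚ.m≤m+n d d′) d+d′≤n))))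
  by-cases (yes d≤n) (yes d′≤n∸d) = trans (shift-≤ e d (shift e′ d′ X) m n d≤n) (trans (shift-≤ e′ d′ X (m - e) (n ∸ d) d′≤n∸d)
    (sym (trans (shift-≤ (e + e′) (d +ₙ d′) X m n d+d′≤n) (cong₂ X (m-[e+e′]≡m-e-e′ m e e′) (sym (ℕₚ.∸-+-assoc n d d′))))))
    where d+d′≤n = subst (d +ₙ d′ ≤ₙ_) (ℕₚ.m+[n∸m]≡n d≤n) (ℕₚ.+-monoʳ-≤ d d′≤n∸d)
  by-cases (yes d≤n) (no d′≰n∸d) = trans (shift-≤ e d (shift e′ d′ X) m n d≤n) (trans (shift-≰ e′ d′ X (m - e) (n ∸ d) d′≰n∸d)
    (sym (shift-≰ (e + e′) (d +ₙ d′) X m n (λ d+d′≤n → d′≰n∸d (subst (_≤ₙ n ∸ d) (ℕₚ.m+n∸m≡n d d′) (ℕₚ.∸-monoˡ-≤ d d+d′≤n))))))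

shift-δ : ∀ e d e′ d′ → shift e d (δ e′ d′) ≈ δ (e + e′) (d +ₙ d′)
shift-δ e d e′ d′ m n = by-cases (d ℕₚ.≤? n)
  where
  e+[m-e]≡m : ∀ m e → m ≡ e + (m - e)
  e+[m-e]≡m = solve-∀
  e+e′-e≡e′ : ∀ e e′ → e + e′ - e ≡ e′
  e+e′-e≡e′ = solve-∀
  by-cases : Dec (d ≤ₙ n) → shift e d (δ e′ d′) m n ≡ δ (e + e′) (d +ₙ d′) m n
  by-cases (no d≰n)  = trans (shift-≰ e d (δ e′ d′) m n d≰n)
    (sym (𝟙-no ((m ℤₚ.≟ e + e′) ×-dec (n ℕₚ.≟ d +ₙ d′)) (λ { (_ , refl) → d≰n (ℕₚ.m≤m+n d d′) })))
  by-cases (yes d≤n) = trans (shift-≤ e d (δ e′ d′) m n d≤n)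
    (𝟙-cong ((m - e ℤₚ.≟ e′) ×-dec (n ∸ d ℕₚ.≟ d′)) ((m ℤₚ.≟ e + e′) ×-dec (n ℕₚ.≟ d +ₙ d′))
      (λ { (refl , refl) → e+[m-e]≡m m e , sym (ℕₚ.m+[n∸m]≡n d≤n) })
      (λ { (refl , refl) → e+e′-e≡e′ e e′ , ℕₚ.m+n∸m≡n d d′ }))

shift₀-≤ : ∀ d X m n → d ≤ₙ n → shift 0ℤ d X m n ≡ X m (n ∸ d)
shift₀-≤ d X m n d≤n = trans (shift-≤ 0ℤ d X m n d≤n) (cong (λ i → X i (n ∸ d)) (ℤₚ.+-identityʳ m))

shift₀≢0⇒ : ∀ d X m n → shift 0ℤ d X m n ≢ 0ℤ → d ≤ₙ n × X m (n ∸ d) ≢ 0ℤ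
shift₀≢0⇒ d X m n shift≢0 with d ℕₚ.≤? n
... | yes d≤n = d≤n , (λ X≡0 → shift≢0 (trans (shift₀-≤ d X m n d≤n) X≡0))
... | no  d≰n = ⊥-elim (shift≢0 (shift-≰ 0ℤ d X m n d≰n))

δ-⊛ : ∀ e d X → ∣ e ∣ ≤ₙ d → (δ e d ⊛ X) ≈ shift e d X
δ-⊛ e d X ∣e∣≤d m n = trans (⊛-coeff (δ e d) X (δ-admissible e d ∣e∣≤d) m n N (s≤s (ℕₚ.m≤m+n n d))) (by-cases (d ℕₚ.≤? n))
  where
  N = suc (n +ₙ d)
  term : ℕ → ℤ
  term k = convolve N ([q^ k ] δ e d) ([q^ (n ∸ k) ] X) m
  term-≢ : ∀ k → k ≢ d → term k ≡ 0ℤ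
  term-≢ k k≢d = ∑±-zero N (λ j → trans (cong (_* X (m - j) (n ∸ k)) (𝟙-no ((j ℤₚ.≟ e) ×-dec (k ℕₚ.≟ d)) (k≢d ∘ proj₂)))
                                        (ℤₚ.*-zeroˡ (X (m - j) (n ∸ k))))
  term-d : term d ≡ X (m - e) (n ∸ d)
  term-d = trans (∑±-single N (λ j → δ e d j d * X (m - j) (n ∸ d)) e (s≤s (ℕₚ.≤-trans ∣e∣≤d (ℕₚ.m≤n+m d n)))
                   (λ j j≢e → trans (cong (_* X (m - j) (n ∸ d)) (𝟙-no ((j ℤₚ.≟ e) ×-dec (d ℕₚ.≟ d)) (j≢e ∘ proj₁)))
                                    (ℤₚ.*-zeroˡ (X (m - j) (n ∸ d)))))
                 (trans (cong (_* X (m - e) (n ∸ d)) (𝟙-yes ((e ℤₚ.≟ e) ×-dec (d ℕₚ.≟ d)) (refl , refl)))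
                        (ℤₚ.*-identityˡ (X (m - e) (n ∸ d))))
  by-cases : Dec (d ≤ₙ n) → ∑< (suc n) term ≡ shift e d X m n
  by-cases (yes d≤n) = trans (∑<-single (suc n) d term (s≤s d≤n) term-≢) (trans term-d (sym (shift-≤ e d X m n d≤n)))
  by-cases (no d≰n)  = trans (∑<-zero (suc n) (λ k k<sn → term-≢ k (λ k≡d → d≰n (subst (_≤ₙ n) k≡d (ℕₚ.≤-pred k<sn)))))
                             (sym (shift-≰ e d X m n d≰n))

one-⊛ : ∀ X → (one ⊛ X) ≈ X
one-⊛ X m n = trans (δ-⊛ (+ 0) 0 X z≤n m n) (trans (shift-≤ (+ 0) 0 X m n z≤n) (cong (λ i → X i n) (ℤₚ.+-identityʳ m)))

module Geometric (ℓ′ : ℕ) where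

  L : ℕ
  L = suc ℓ′

  geomInv-admissible : ∀ e → ∣ e ∣ ≤ₙ 1 → Admissible (geomInv e ℓ′)
  geomInv-admissible e ∣e∣≤1 n m n<∣m∣ =
    𝟙-no ((n % L ℕₚ.≟ 0) ×-dec (m ℤₚ.≟ + (n / L) * e)) (λ { (_ , m≡[n/L]e) → ℕₚ.<⇒≱ n<∣m∣ (∣m∣≤n m≡[n/L]e) })
    where
    ∣m∣≤n : m ≡ + (n / L) * e → ∣ m ∣ ≤ₙ n
    ∣m∣≤n refl = begin
      ∣ + (n / L) * e ∣    ≡⟨ ℤₚ.∣i*j∣≡∣i∣*∣j∣ (+ (n / L)) e ⟩
      n / L *ₙ ∣ e ∣       ≤⟨ ℕₚ.*-monoʳ-≤ (n / L) ∣e∣≤1 ⟩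
      n / L *ₙ 1           ≡⟨ ℕₚ.*-identityʳ (n / L) ⟩
      n / L                ≤⟨ m/n≤m n L ⟩
      n                    ∎
      where open ℕₚ.≤-Reasoning

  geomInv-unfold : ∀ e → geomInv e ℓ′ ≈ (one ⊕ shift e L (geomInv e ℓ′))
  geomInv-unfold e m n with L ℕₚ.≤? n
  ... | no L≰n = trans
    (𝟙-cong ((n % L ℕₚ.≟ 0) ×-dec (m ℤₚ.≟ + (n / L) * e)) ((m ℤₚ.≟ + 0) ×-dec (n ℕₚ.≟ 0))
      (λ { (n%L≡0 , refl) → trans (cong (λ q → + q * e) n/L≡0) (ℤₚ.*-zeroˡ e) , trans (sym n%L≡n) n%L≡0 })
      (λ { (refl , refl) → refl , sym (trans (cong (λ q → + q * e) n/L≡0) (ℤₚ.*-zeroˡ e)) }))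
    (sym (trans (cong (λ s → one m n + s) (shift-≰ e L (geomInv e ℓ′) m n L≰n)) (ℤₚ.+-identityʳ (one m n))))
    where
    n<L = ℕₚ.≰⇒> L≰n
    n/L≡0 = m<n⇒m/n≡0 n<L
    n%L≡n = m<n⇒m%n≡m n<L
  ... | yes L≤n = trans
    (𝟙-cong ((n % L ℕₚ.≟ 0) ×-dec (m ℤₚ.≟ + (n / L) * e)) (((n ∸ L) % L ℕₚ.≟ 0) ×-dec (m - e ℤₚ.≟ + ((n ∸ L) / L) * e))
      (λ { (n%L≡0 , refl) → trans [n∸L]%L≡n%L n%L≡0 , trans (cong (λ q → + q * e - e) n/L≡1+[n∸L]/L) (peel-e (+ ((n ∸ L) / L)) e) })
      (λ { ([n∸L]%L≡0 , m-e≡) → trans (sym [n∸L]%L≡n%L) [n∸L]%L≡0 ,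
                                trans (unpeel-e m e) (trans (cong (λ s → e + s) m-e≡) (trans (e+qe (+ ((n ∸ L) / L)) e)
                                      (cong (λ q → + q * e) (sym n/L≡1+[n∸L]/L)))) }))
    (sym (trans (cong₂ _+_ (𝟙-no ((m ℤₚ.≟ + 0) ×-dec (n ℕₚ.≟ 0)) (λ { (_ , refl) → ℕₚ.<⇒≱ (s≤s z≤n) L≤n }))
                           (shift-≤ e L (geomInv e ℓ′) m n L≤n))
                (ℤₚ.+-identityˡ _)))
    where
    [n∸L]%L≡n%L : (n ∸ L) % L ≡ n % L
    [n∸L]%L≡n%L = trans (sym ([m+n]%n≡m%n (n ∸ L) L)) (cong (_% L) (ℕₚ.m∸n+n≡m L≤n))
    n/L≡1+[n∸L]/L : n / L ≡ 1 +ₙ (n ∸ L) / L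
    n/L≡1+[n∸L]/L = m/n≡1+[m∸n]/n L≤n
    peel-e : ∀ q e → (1ℤ + q) * e - e ≡ q * e
    peel-e = solve-∀
    unpeel-e : ∀ m e → m ≡ e + (m - e)
    unpeel-e = solve-∀
    e+qe : ∀ q e → e + q * e ≡ (1ℤ + q) * e
    e+qe = solve-∀

  geomSum : ℤ → ℕ → Series
  geomSum e B = ∑ˢ B (λ i → δ (+ i * e) (i *ₙ L))

  geomInv-unroll : ∀ e B → geomInv e ℓ′ ≈ (geomSum e B ⊕ shift (+ B * e) (B *ₙ L) (geomInv e ℓ′))
  geomInv-unroll e zero m n = sym (begin
    0ℤ + shift (+ 0 * e) 0 G m n  ≡⟨ ℤₚ.+-identityˡ _ ⟩
    shift (+ 0 * e) 0 G m n       ≡⟨ shift-≤ (+ 0 * e) 0 G m n z≤n ⟩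
    G (m - + 0 * e) n             ≡⟨ cong (λ i → G (m - i) n) (ℤₚ.*-zeroˡ e) ⟩
    G (m - + 0) n                 ≡⟨ cong (λ i → G i n) (ℤₚ.+-identityʳ m) ⟩
    G m n                         ∎)
    where
    open ≡-Reasoning
    G = geomInv e ℓ′
  geomInv-unroll e (suc B) m n = begin
    G m n
      ≡⟨ geomInv-unroll e B m n ⟩
    geomSum e B m n + shift Be BL G m n
      ≡⟨ cong (λ s → geomSum e B m n + s) (shift-cong Be BL (geomInv-unfold e) m n) ⟩
    geomSum e B m n + shift Be BL (one ⊕ shift e L G) m n
      ≡⟨ cong (λ s → geomSum e B m n + s) (shift-⊕ Be BL one (shift e L G) m n) ⟩
    geomSum e B m n + (shift Be BL one m n + shift Be BL (shift e L G) m n)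
      ≡⟨ cong₂ (λ x y → geomSum e B m n + (x + y)) (shift-δ Be BL (+ 0) 0 m n) (shift-shift Be BL e L G m n) ⟩
    geomSum e B m n + (δ (Be + + 0) (BL +ₙ 0) m n + shift (Be + e) (BL +ₙ L) G m n)
      ≡⟨ cong₂ (λ x y → geomSum e B m n + (x + y))
               (cong₂ (λ u v → δ u v m n) (ℤₚ.+-identityʳ Be) (ℕₚ.+-identityʳ BL))
               (cong₂ (λ u v → shift u v G m n) (qe+e≡[1+q]e (+ B) e) (ℕₚ.+-comm BL L)) ⟩
    geomSum e B m n + (δ Be BL m n + shift (+ suc B * e) (suc B *ₙ L) G m n)
      ≡⟨ ℤₚ.+-assoc (geomSum e B m n) _ _ ⟨
    geomSum e (suc B) m n + shift (+ suc B * e) (suc B *ₙ L) G m n ∎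
    where
    open ≡-Reasoning
    G = geomInv e ℓ′
    Be = + B * e
    BL = B *ₙ L
    qe+e≡[1+q]e : ∀ q e → q * e + e ≡ (1ℤ + q) * e
    qe+e≡[1+q]e = solve-∀

  oneMinus-⊛-geomInv : ∀ e B {E} → ∣ e ∣ ≤ₙ 1 → E ≡ + B * e → (oneMinus E (B *ₙ L) ⊛ geomInv e ℓ′) ≈ geomSum e B
  oneMinus-⊛-geomInv e B {E} ∣e∣≤1 refl m n = begin
    ((one ⊝ δ E BL) ⊛ G) m n                               ≡⟨ ⊛-distribʳ-⊝ one (δ E BL) G m n ⟩
    (one ⊛ G) m n - (δ E BL ⊛ G) m n                       ≡⟨ cong₂ _-_ (one-⊛ G m n) (δ-⊛ E BL G ∣E∣≤BL m n) ⟩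
    G m n - shift E BL G m n                               ≡⟨ cong (_- shift E BL G m n) (geomInv-unroll e B m n) ⟩
    geomSum e B m n + shift E BL G m n - shift E BL G m n  ≡⟨ x+y-y≡x (geomSum e B m n) (shift E BL G m n) ⟩
    geomSum e B m n                                        ∎
    where
    open ≡-Reasoning
    G = geomInv e ℓ′
    BL = B *ₙ L
    x+y-y≡x : ∀ x y → x + y - y ≡ x
    x+y-y≡x = solve-∀
    ∣E∣≤BL : ∣ + B * e ∣ ≤ₙ BL
    ∣E∣≤BL = subst (_≤ₙ BL) (sym (ℤₚ.∣i*j∣≡∣i∣*∣j∣ (+ B) e)) (ℕₚ.*-monoʳ-≤ B (ℕₚ.≤-trans ∣e∣≤1 (s≤s z≤n)))

  geomInv-truncate : ∀ e n → geomInv e ℓ′ ≈[ n ] geomSum e (suc n)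
  geomInv-truncate e n m k k≤n = trans (geomInv-unroll e (suc n) m k)
    (trans (cong (λ s → geomSum e (suc n) m k + s) (shift-≰ (+ suc n * e) (suc n *ₙ L) (geomInv e ℓ′) m k [1+n]L≰k))
           (ℤₚ.+-identityʳ _))
    where [1+n]L≰k = λ [1+n]L≤k → ℕₚ.<⇒≱ (s≤s k≤n) (ℕₚ.≤-trans (ℕₚ.m≤m*n (suc n) L) [1+n]L≤k)

Symmetric : (ℤ → ℤ) → Set
Symmetric x = ∀ m → x (- m) ≡ x m

Nonneg : (ℤ → ℤ) → Set
Nonneg x = ∀ m → 0ℤ ≤ x m

DecreasingBy : ℕ → (ℤ → ℤ) → Set
DecreasingBy a x = ∀ k → x (+ (k +ₙ a)) ≤ x (+ k)

StrictlyDecreasingBy : ℕ → (ℤ → ℤ) → Set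
StrictlyDecreasingBy a x = ∀ k → x (+ k) ≢ 0ℤ → x (+ (k +ₙ a)) < x (+ k)

record IsUnimodal (a : ℕ) (x : ℤ → ℤ) : Set where
  field
    symmetric  : Symmetric x
    nonneg     : Nonneg x
    decreasing : DecreasingBy a x

private
  *-nonneg : ∀ {i j} → 0ℤ ≤ i → 0ℤ ≤ j → 0ℤ ≤ i * j
  *-nonneg {+ i} {+ j} _ _ = subst (0ℤ ≤_) (ℤₚ.pos-* i j) (ℤ.+≤+ z≤n)

  *-pos : ∀ {i j} → 0ℤ < i → 0ℤ < j → 0ℤ < i * j
  *-pos {+ suc i} {+ suc j} _ _ = subst (0ℤ <_) (ℤₚ.pos-* (suc i) (suc j)) (ℤ.+<+ (s≤s z≤n))
  *-pos {+ zero}  (ℤ.+<+ ())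
  *-pos {+ suc _} {+ zero} _ (ℤ.+<+ ())

  0≤i+i⇒0≤i : ∀ {i} → 0ℤ ≤ i + i → 0ℤ ≤ i
  0≤i+i⇒0≤i {+ _} _ = ℤ.+≤+ z≤n

  0<i+i⇒0<i : ∀ {i} → 0ℤ < i + i → 0ℤ < i
  0<i+i⇒0<i {+ suc _} _ = ℤ.+<+ (s≤s z≤n)
  0<i+i⇒0<i {+ zero} (ℤ.+<+ ())

  0<i-j⇒j<i : ∀ {i j} → 0ℤ < i - j → j < i
  0<i-j⇒j<i {i} {j} 0<i-j = subst₂ _<_ (ℤₚ.+-identityˡ j) (x-y+y≡x i j) (ℤₚ.+-monoˡ-< j 0<i-j)
    where x-y+y≡x : ∀ x y → x - y + y ≡ x
          x-y+y≡x = solve-∀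

  j<i⇒0<i-j : ∀ {i j} → j < i → 0ℤ < i - j
  j<i⇒0<i-j {i} {j} j<i = subst (_< i - j) (ℤₚ.+-inverseʳ j) (ℤₚ.+-monoˡ-< (- j) j<i)

  ∣k-t∣ : ∀ k t → ∃ λ u → ∃ λ w → (+ k - + t ≡ + u ⊎ + k - + t ≡ - + u) × k +ₙ t ≡ u +ₙ (w +ₙ w)
  ∣k-t∣ k t with t ℕₚ.≤? k
  ... | yes t≤k = k ∸ t , t , inj₁ (trans (ℤₚ.m-n≡m⊖n k t) (ℤₚ.⊖-≥ t≤k)) ,
                  trans (cong (_+ₙ t) (sym (ℕₚ.m∸n+n≡m t≤k))) (ℕₚ.+-assoc (k ∸ t) t t)
  ... | no t≰k  = t ∸ k , k , inj₂ (trans (ℤₚ.m-n≡m⊖n k t) (ℤₚ.⊖-< t>k)) ,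
                  trans (cong (k +ₙ_) (sym (ℕₚ.m∸n+n≡m (ℕₚ.<⇒≤ t>k)))) (u+k+k (t ∸ k) k)
    where
    t>k = ℕₚ.≰⇒> t≰k
    u+k+k : ∀ u k → k +ₙ (u +ₙ k) ≡ u +ₙ (k +ₙ k)
    u+k+k = ℕ-Solver.solve-∀

  w+w≡s*a : ∀ {a} → a ≡ 1 ⊎ a ≡ 2 → ∀ w → ∃ λ s → w +ₙ w ≡ s *ₙ a
  w+w≡s*a (inj₁ refl) w = w +ₙ w , sym (ℕₚ.*-identityʳ _)
  w+w≡s*a (inj₂ refl) w = w , w+w≡w*2 w
    where w+w≡w*2 : ∀ w → w +ₙ w ≡ w *ₙ 2
          w+w≡w*2 = ℕ-Solver.solve-∀

decreasing-iterate : ∀ {a x} → DecreasingBy a x → ∀ u s → x (+ (u +ₙ s *ₙ a)) ≤ x (+ u)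
decreasing-iterate {a} {x} x-dec u zero    = ℤₚ.≤-reflexive (cong (x ∘ +_) (ℕₚ.+-identityʳ u))
decreasing-iterate {a} {x} x-dec u (suc s) = ℤₚ.≤-trans (ℤₚ.≤-reflexive (cong (x ∘ +_) (regroup u s a)))
                                                        (ℤₚ.≤-trans (x-dec (u +ₙ s *ₙ a)) (decreasing-iterate {a} {x} x-dec u s))
  where regroup : ∀ u s a → u +ₙ (a +ₙ s *ₙ a) ≡ u +ₙ s *ₙ a +ₙ a
        regroup = ℕ-Solver.solve-∀

module _ {a : ℕ} (a∈12 : a ≡ 1 ⊎ a ≡ 2) {x : ℤ → ℤ} (x-unimodal : IsUnimodal a x) where
  open IsUnimodal x-unimodal

  decreasing-across : ∀ k t → ∃ λ u → x (+ k - + t) ≡ x (+ u) × x (+ (k +ₙ a +ₙ t)) ≤ x (+ (u +ₙ a))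
  decreasing-across k t with ∣k-t∣ k t
  ... | u , w , k-t≡±u , k+t≡u+2w = u , x[k-t]≡x[u] k-t≡±u ,
        ℤₚ.≤-trans (ℤₚ.≤-reflexive (cong (x ∘ +_) k+a+t≡u+a+sa)) (decreasing-iterate {a} {x} decreasing (u +ₙ a) s)
    where
    s = proj₁ (w+w≡s*a a∈12 w)
    swapʳ : ∀ p q r → p +ₙ q +ₙ r ≡ p +ₙ r +ₙ q
    swapʳ = ℕ-Solver.solve-∀
    k+a+t≡u+a+sa : k +ₙ a +ₙ t ≡ u +ₙ a +ₙ s *ₙ a
    k+a+t≡u+a+sa = trans (swapʳ k a t) (trans (cong (_+ₙ a) k+t≡u+2w)
                     (trans (swapʳ u (w +ₙ w) a) (cong (u +ₙ a +ₙ_) (proj₂ (w+w≡s*a a∈12 w)))))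
    x[k-t]≡x[u] : + k - + t ≡ + u ⊎ + k - + t ≡ - + u → x (+ k - + t) ≡ x (+ u)
    x[k-t]≡x[u] (inj₁ eq) = cong x eq
    x[k-t]≡x[u] (inj₂ eq) = trans (cong x eq) (symmetric (+ u))

  decreasing-across-nonneg : ∀ k t → 0ℤ ≤ x (+ k - + t) - x (+ (k +ₙ a +ₙ t))
  decreasing-across-nonneg k t with decreasing-across k t
  ... | u , x[k-t]≡x[u] , far≤ = ℤₚ.i≤j⇒0≤j-i (ℤₚ.≤-trans far≤ (ℤₚ.≤-trans (decreasing u) (ℤₚ.≤-reflexive (sym x[k-t]≡x[u]))))

  decreasing-across-pos : StrictlyDecreasingBy a x → ∀ k t → x (+ k - + t) ≢ 0ℤ → 0ℤ < x (+ k - + t) - x (+ (k +ₙ a +ₙ t))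
  decreasing-across-pos strict k t x[k-t]≢0 with decreasing-across k t
  ... | u , x[k-t]≡x[u] , far≤ = j<i⇒0<i-j (ℤₚ.≤-<-trans far≤
        (subst (x (+ (u +ₙ a)) <_) (sym x[k-t]≡x[u]) (strict u (λ x[u]≡0 → x[k-t]≢0 (trans x[k-t]≡x[u] x[u]≡0)))))

module UnimodalConvolution {a : ℕ} (a∈12 : a ≡ 1 ⊎ a ≡ 2) {K : ℕ} {x y : ℤ → ℤ}
  (x≡0 : VanishesBeyond K x) (y≡0 : VanishesBeyond K y) (x-unimodal : IsUnimodal a x) (y-unimodal : IsUnimodal a y) where

  private
    module Y = IsUnimodal y-unimodal

  drop : ℕ → ℕ → ℤ
  drop N k = convolve N x y (+ k) - convolve N x y (+ (k +ₙ a))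

  Δy : ℤ → ℤ
  Δy j = y j - y (j + + a)

  pairedTerm : ℕ → ℤ → ℤ
  pairedTerm k j = (x (+ k - j) - x (+ (k +ₙ a) + j)) * Δy j

  drop-as-sum : ∀ k N → K +ₙ k <ₙ N → drop N k ≡ ∑± N (λ j → x (+ k - j) * Δy j)
  drop-as-sum k N lt = begin
    convolve N x y (+ k) - convolve N x y (+ (k +ₙ a))
      ≡⟨ ∑±-- N (λ j → x j * y (+ k - j)) (λ j → x j * y (+ (k +ₙ a) - j)) ⟨
    ∑± N (λ j → x j * y (+ k - j) - x j * y (+ (k +ₙ a) - j))
      ≡⟨ ∑±-cong N (λ j → u*v-u*w≡u*[v-w] (x j) (y (+ k - j)) (y (+ (k +ₙ a) - j))) ⟩
    ∑± N φ
      ≡⟨ ∑±-reflect-shift K φ (VanishesBeyond-*ʳ K x _ x≡0) (+ k) N lt ⟨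
    ∑± N (λ j → φ (+ k - j))
      ≡⟨ ∑±-cong N (λ j → cong₂ (λ u v → x (+ k - j) * (y u - y v)) (k-[k-j]≡j (+ k) j) (k+a-[k-j]≡j+a (+ k) (+ a) j)) ⟩
    ∑± N (λ j → x (+ k - j) * Δy j) ∎
    where
    open ≡-Reasoning
    φ : ℤ → ℤ
    φ j = x j * (y (+ k - j) - y (+ (k +ₙ a) - j))
    u*v-u*w≡u*[v-w] : ∀ u v w → u * v - u * w ≡ u * (v - w)
    u*v-u*w≡u*[v-w] = solve-∀
    k-[k-j]≡j : ∀ k j → k - (k - j) ≡ j
    k-[k-j]≡j = solve-∀
    k+a-[k-j]≡j+a : ∀ k a j → k + a - (k - j) ≡ j + a
    k+a-[k-j]≡j+a = solve-∀

  drop-as-reflected-sum : ∀ k N → K +ₙ (k +ₙ a) <ₙ N → drop N k ≡ - ∑± N (λ j → x (+ (k +ₙ a) + j) * Δy j)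
  drop-as-reflected-sum k N lt = begin
    drop N k                                           ≡⟨ drop-as-sum k N (ℕₚ.≤-<-trans (ℕₚ.+-monoʳ-≤ K (ℕₚ.m≤m+n k a)) lt) ⟩
    ∑± N φ                                             ≡⟨ ∑±-reflect-shift (K +ₙ k) φ φ≡0 (- + a) N lt′ ⟨
    ∑± N (λ j → φ (- + a - j))                         ≡⟨ ∑±-cong N reflected ⟩
    ∑± N (λ j → - (x (+ (k +ₙ a) + j) * Δy j))         ≡⟨ ∑±-neg N (λ j → x (+ (k +ₙ a) + j) * Δy j) ⟩
    - ∑± N (λ j → x (+ (k +ₙ a) + j) * Δy j)           ∎
    where
    open ≡-Reasoning
    φ : ℤ → ℤ
    φ j = x (+ k - j) * Δy j
    φ≡0 : VanishesBeyond (K +ₙ k) φ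
    φ≡0 = VanishesBeyond-*ʳ (K +ₙ k) (λ j → x (+ k - j)) Δy (VanishesBeyond-reflect-shift K x (+ k) x≡0)
    lt′ : K +ₙ k +ₙ ∣ - + a ∣ <ₙ N
    lt′ = subst (λ n → n <ₙ N) (trans (sym (ℕₚ.+-assoc K k a)) (cong (K +ₙ k +ₙ_) (sym (ℤₚ.∣-i∣≡∣i∣ (+ a))))) lt
    k-[-a-j]≡k+a+j : ∀ k a j → k - (- a - j) ≡ k + a + j
    k-[-a-j]≡k+a+j = solve-∀
    -a-j≡-[j+a] : ∀ a j → - a - j ≡ - (j + a)
    -a-j≡-[j+a] = solve-∀
    -a-j+a≡-j : ∀ a j → - a - j + a ≡ - j
    -a-j+a≡-j = solve-∀
    u*[v-w]≡-[u*[w-v]] : ∀ u v w → u * (v - w) ≡ - (u * (w - v))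
    u*[v-w]≡-[u*[w-v]] = solve-∀
    reflected : ∀ j → φ (- + a - j) ≡ - (x (+ (k +ₙ a) + j) * Δy j)
    reflected j = trans (cong₂ (λ u v → x u * (v - y (- + a - j + + a)))
                              (k-[-a-j]≡k+a+j (+ k) (+ a) j) (trans (cong y (-a-j≡-[j+a] (+ a) j)) (Y.symmetric (j + + a))))
                        (trans (cong (λ v → x (+ (k +ₙ a) + j) * (y (j + + a) - v)) (trans (cong y (-a-j+a≡-j (+ a) j)) (Y.symmetric j)))
                               (u*[v-w]≡-[u*[w-v]] (x (+ (k +ₙ a) + j)) (y (j + + a)) (y j)))

  twice-drop : ∀ k N → K +ₙ (k +ₙ a) <ₙ N → drop N k + drop N k ≡ ∑± N (pairedTerm k)
  twice-drop k N lt = begin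
    drop N k + drop N k                                                              ≡⟨ cong₂ _+_ (drop-as-sum k N lt₀) (drop-as-reflected-sum k N lt) ⟩
    ∑± N (λ j → x (+ k - j) * Δy j) - ∑± N (λ j → x (+ (k +ₙ a) + j) * Δy j)        ≡⟨ ∑±-- N (λ j → x (+ k - j) * Δy j) (λ j → x (+ (k +ₙ a) + j) * Δy j) ⟨
    ∑± N (λ j → x (+ k - j) * Δy j - x (+ (k +ₙ a) + j) * Δy j)                      ≡⟨ ∑±-cong N (λ j → u*w-v*w≡[u-v]*w (x (+ k - j)) (x (+ (k +ₙ a) + j)) (Δy j)) ⟩
    ∑± N (pairedTerm k)                                                              ∎
    where
    open ≡-Reasoning
    lt₀ = ℕₚ.≤-<-trans (ℕₚ.+-monoʳ-≤ K (ℕₚ.m≤m+n k a)) lt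
    u*w-v*w≡[u-v]*w : ∀ u v w → u * w - v * w ≡ (u - v) * w
    u*w-v*w≡[u-v]*w = solve-∀

  pairedTerm-reflect : ∀ k j → pairedTerm k (- + a - j) ≡ pairedTerm k j
  pairedTerm-reflect k j = begin
    (x (+ k - (- + a - j)) - x (+ (k +ₙ a) + (- + a - j))) * (y (- + a - j) - y (- + a - j + + a))
      ≡⟨ cong₂ (λ u v → (x u - x v) * (y (- + a - j) - y (- + a - j + + a))) (k-[-a-j]≡k+a+j (+ k) (+ a) j) (k+a+[-a-j]≡k-j (+ k) (+ a) j) ⟩
    (x (+ (k +ₙ a) + j) - x (+ k - j)) * (y (- + a - j) - y (- + a - j + + a))
      ≡⟨ cong₂ (λ u v → (x (+ (k +ₙ a) + j) - x (+ k - j)) * (u - v))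
               (trans (cong y (-a-j≡-[j+a] (+ a) j)) (Y.symmetric (j + + a))) (trans (cong y (-a-j+a≡-j (+ a) j)) (Y.symmetric j)) ⟩
    (x (+ (k +ₙ a) + j) - x (+ k - j)) * (y (j + + a) - y j)
      ≡⟨ [v-u]*[w-z]≡[u-v]*[z-w] (x (+ k - j)) (x (+ (k +ₙ a) + j)) (y j) (y (j + + a)) ⟩
    pairedTerm k j ∎
    where
    open ≡-Reasoning
    k-[-a-j]≡k+a+j : ∀ k a j → k - (- a - j) ≡ k + a + j
    k-[-a-j]≡k+a+j = solve-∀
    k+a+[-a-j]≡k-j : ∀ k a j → k + a + (- a - j) ≡ k - j
    k+a+[-a-j]≡k-j = solve-∀
    -a-j≡-[j+a] : ∀ a j → - a - j ≡ - (j + a)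
    -a-j≡-[j+a] = solve-∀
    -a-j+a≡-j : ∀ a j → - a - j + a ≡ - j
    -a-j+a≡-j = solve-∀
    [v-u]*[w-z]≡[u-v]*[z-w] : ∀ u v z w → (v - u) * (w - z) ≡ (u - v) * (z - w)
    [v-u]*[w-z]≡[u-v]*[z-w] = solve-∀

  pairedTerm-nonneg : ∀ k j → 0ℤ ≤ pairedTerm k j
  pairedTerm-nonneg k (+ t)    = *-nonneg (decreasing-across-nonneg a∈12 x-unimodal k t) (ℤₚ.i≤j⇒0≤j-i (Y.decreasing t))
  pairedTerm-nonneg k -[1+ t ] = negative-index a∈12 t
    where
    -- pairedTerm-reflect folds -[1+ t ] onto a nonnegative index, except for j = -1 when a = 2.
    negative-index : a ≡ 1 ⊎ a ≡ 2 → ∀ t → 0ℤ ≤ pairedTerm k -[1+ t ]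
    negative-index (inj₁ refl) t       = subst (0ℤ ≤_) (pairedTerm-reflect k -[1+ t ]) (pairedTerm-nonneg k (+ t))
    negative-index (inj₂ refl) (suc s) = subst (0ℤ ≤_) (pairedTerm-reflect k -[1+ suc s ]) (pairedTerm-nonneg k (+ s))
    negative-index (inj₂ refl) zero    = ℤₚ.≤-reflexive (sym (trans (cong (λ v → d * (v - y (+ 1))) (Y.symmetric (+ 1)))
                                                                    (trans (cong (d *_) (ℤₚ.+-inverseʳ (y (+ 1)))) (ℤₚ.*-zeroʳ d))))
      where d = x (+ k - -[1+ 0 ]) - x (+ (k +ₙ 2) + -[1+ 0 ])

  convolve-decreasing : ∀ k N → K +ₙ (k +ₙ a) <ₙ N → convolve N x y (+ (k +ₙ a)) ≤ convolve N x y (+ k)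
  convolve-decreasing k N lt =
    ℤₚ.0≤i-j⇒j≤i (0≤i+i⇒0≤i (subst (0ℤ ≤_) (sym (twice-drop k N lt)) (∑±-nonneg N (pairedTerm-nonneg k))))

  convolve-strictly-decreasing : StrictlyDecreasingBy a x → StrictlyDecreasingBy a y →
    ∀ k N → K +ₙ (k +ₙ a) <ₙ N → ∀ t → x (+ k - + t) ≢ 0ℤ → y (+ t) ≢ 0ℤ → convolve N x y (+ (k +ₙ a)) < convolve N x y (+ k)
  convolve-strictly-decreasing x-strict y-strict k N lt t x[k-t]≢0 y[t]≢0 =
    0<i-j⇒j<i (0<i+i⇒0<i (subst (0ℤ <_) (sym (twice-drop k N lt))
      (ℤₚ.<-≤-trans pairedTerm-pos (term≤∑± N (pairedTerm-nonneg k) t t<N))))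
    where
    pairedTerm-pos : 0ℤ < pairedTerm k (+ t)
    pairedTerm-pos = *-pos (decreasing-across-pos a∈12 x-unimodal x-strict k t x[k-t]≢0) (j<i⇒0<i-j (y-strict t y[t]≢0))
    t<N : t <ₙ N
    t<N = ℕₚ.≤-<-trans (ℕₚ.≮⇒≥ (λ K<t → y[t]≢0 (y≡0 (+ t) K<t))) (ℕₚ.≤-<-trans (ℕₚ.m≤m+n K (k +ₙ a)) lt)

convolve-symmetric : ∀ K x y → VanishesBeyond K x → Symmetric x → Symmetric y → ∀ N → K <ₙ N → Symmetric (convolve N x y)
convolve-symmetric K x y x≡0 x-sym y-sym N K<N m = begin
  ∑± N (λ j → x j * y (- m - j))         ≡⟨ ∑±-reflect K (λ j → x j * y (- m - j)) (VanishesBeyond-*ʳ K x _ x≡0) N K<N ⟨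
  ∑± N (λ j → x (- j) * y (- m - - j))   ≡⟨ ∑±-cong N (λ j → cong₂ _*_ (x-sym j) (trans (cong y (-m+j≡-[m-j] m j)) (y-sym (m - j)))) ⟩
  ∑± N (λ j → x j * y (m - j))           ∎
  where
  open ≡-Reasoning
  -m+j≡-[m-j] : ∀ m j → - m - - j ≡ - (m - j)
  -m+j≡-[m-j] = solve-∀

convolve-nonneg : ∀ x y → Nonneg x → Nonneg y → ∀ N → Nonneg (convolve N x y)
convolve-nonneg x y x≥0 y≥0 N m = ∑±-nonneg N (λ j → *-nonneg (x≥0 j) (y≥0 (m - j)))

convolve-strictly-decreasing : ∀ {a} → a ≡ 1 ⊎ a ≡ 2 → ∀ {K x y} → VanishesBeyond K x → VanishesBeyond K y →
  IsUnimodal a x → IsUnimodal a y → StrictlyDecreasingBy a x → StrictlyDecreasingBy a y →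
  ∀ k N → K +ₙ (k +ₙ a) <ₙ N → convolve N x y (+ k) ≢ 0ℤ → convolve N x y (+ (k +ₙ a)) < convolve N x y (+ k)
convolve-strictly-decreasing {a} a∈12 {K} {x} {y} x≡0 y≡0 x-uni y-uni x-strict y-strict k N lt c≢0
  with ∑±-nonzero N (λ i → x i * y (+ k - i)) c≢0
... | i , term≢0 = by-sign (+ k - i) refl
  where
  k-[k-i]≡i : ∀ k i → k - (k - i) ≡ i
  k-[k-i]≡i = solve-∀
  -- If the nonzero term has y at a negative index, x is at a positive one: swap the factors.
  by-sign : ∀ j → + k - i ≡ j → convolve N x y (+ (k +ₙ a)) < convolve N x y (+ k)
  by-sign (+ t) k-i≡t = UnimodalConvolution.convolve-strictly-decreasing a∈12 x≡0 y≡0 x-uni y-uni x-strict y-strict k N lt t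
    (λ x≡0′ → term≢0 (trans (cong (λ j → x j * y (+ k - i)) (trans (sym (k-[k-i]≡i (+ k) i)) (cong (λ j → + k - j) k-i≡t)))
                            (trans (cong (_* y (+ k - i)) x≡0′) (ℤₚ.*-zeroˡ (y (+ k - i))))))
    (λ y≡0′ → term≢0 (trans (cong (λ j → x i * y j) k-i≡t) (trans (cong (x i *_) y≡0′) (ℤₚ.*-zeroʳ (x i)))))
  by-sign -[1+ t ] k-i≡-[1+t] = subst₂ _<_
    (sym (convolve-comm K x y x≡0 y≡0 (+ (k +ₙ a)) N lt)) (sym (convolve-comm K x y x≡0 y≡0 (+ k) N lt₀))
    (UnimodalConvolution.convolve-strictly-decreasing a∈12 y≡0 x≡0 y-uni x-uni y-strict x-strict k N lt (k +ₙ suc t)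
      (λ y≡0′ → term≢0 (trans (cong (λ j → x i * y (+ k - j)) i≡k+1+t) (trans (cong (x i *_) y≡0′) (ℤₚ.*-zeroʳ (x i)))))
      (λ x≡0′ → term≢0 (trans (cong (λ j → x j * y (+ k - i)) i≡k+1+t) (trans (cong (_* y (+ k - i)) x≡0′) (ℤₚ.*-zeroˡ (y (+ k - i)))))))
    where
    lt₀ = ℕₚ.≤-<-trans (ℕₚ.+-monoʳ-≤ K (ℕₚ.m≤m+n k a)) lt
    i≡k+1+t : i ≡ + (k +ₙ suc t)
    i≡k+1+t = trans (sym (k-[k-i]≡i (+ k) i)) (cong (λ j → + k - j) k-i≡-[1+t])

IsUnimodal-≗ : ∀ {a x y} → (∀ m → x m ≡ y m) → IsUnimodal a y → IsUnimodal a x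
IsUnimodal-≗ {x = x} {y} x≗y y-uni = record
  { symmetric  = λ m → trans (x≗y (- m)) (trans (symmetric m) (sym (x≗y m)))
  ; nonneg     = λ m → subst (0ℤ ≤_) (sym (x≗y m)) (nonneg m)
  ; decreasing = λ k → subst₂ _≤_ (sym (x≗y _)) (sym (x≗y _)) (decreasing k)
  }
  where open IsUnimodal y-uni

StrictlyDecreasingBy-≗ : ∀ {a x y} → (∀ m → x m ≡ y m) → StrictlyDecreasingBy a y → StrictlyDecreasingBy a x
StrictlyDecreasingBy-≗ x≗y y-strict k x≢0 = subst₂ _<_ (sym (x≗y _)) (sym (x≗y _)) (y-strict k (λ y≡0 → x≢0 (trans (x≗y _) y≡0)))

shift₀-mono : ∀ d X {m₁ m₂} n → (∀ n′ → X m₁ n′ ≤ X m₂ n′) → shift 0ℤ d X m₁ n ≤ shift 0ℤ d X m₂ n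
shift₀-mono d X {m₁} {m₂} n X≤ = subst₂ _≤_ (cong (λ i → 𝟙 (d ℕₚ.≤? n) * X i (n ∸ d)) (sym (ℤₚ.+-identityʳ m₁)))
                                             (cong (λ i → 𝟙 (d ℕₚ.≤? n) * X i (n ∸ d)) (sym (ℤₚ.+-identityʳ m₂)))
  (ℤₚ.*-monoˡ-≤-nonNeg (𝟙 (d ℕₚ.≤? n)) {{nonNegative (𝟙-nonneg (d ℕₚ.≤? n))}} (X≤ (n ∸ d)))

shifts₀-unimodal : ∀ {a X} → (∀ n → IsUnimodal a ([q^ n ] X)) → ∀ C (d : ℕ → ℕ) n →
  IsUnimodal a ([q^ n ] (∑ˢ C (λ t → shift 0ℤ (d t) X)))
shifts₀-unimodal {a} {X} X-uni C d n = record
  { symmetric  = λ m → ∑<-cong C (λ t → trans (shift₀ (d t) (- m)) (trans (cong (𝟙 (d t ℕₚ.≤? n) *_) (symmetric (n ∸ d t) m))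
                                                                            (sym (shift₀ (d t) m))))
  ; nonneg     = λ m → ∑<-nonneg C (λ t _ → subst (0ℤ ≤_) (sym (shift₀ (d t) m)) (*-nonneg (𝟙-nonneg (d t ℕₚ.≤? n)) (nonneg (n ∸ d t) m)))
  ; decreasing = λ k → ∑<-mono-≤ C (λ t _ → shift₀-mono (d t) X n (λ n′ → decreasing n′ k))
  }
  where
  open module Xₙ n = IsUnimodal (X-uni n)
  shift₀ : ∀ d m → shift 0ℤ d X m n ≡ 𝟙 (d ℕₚ.≤? n) * X m (n ∸ d)
  shift₀ d m = cong (λ i → 𝟙 (d ℕₚ.≤? n) * X i (n ∸ d)) (ℤₚ.+-identityʳ m)

-- A nonzero coefficient of z^k at degree n lies T steps of L above degree kL, where the
-- decrease is strict; the term of index T of the sum brings that degree up to n.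
shifts₀-strictly-decreasing : ∀ {a X} (L : ℕ) .{{_ : NonZero L}} → (∀ n → IsUnimodal a ([q^ n ] X)) →
  (∀ k n → X (+ k) n ≢ 0ℤ → (∃ λ T → n ≡ T *ₙ L +ₙ k *ₙ L) × X (+ (k +ₙ a)) (k *ₙ L) < X (+ k) (k *ₙ L)) →
  ∀ n → StrictlyDecreasingBy a ([q^ n ] (∑ˢ (suc n) (λ t → shift 0ℤ (t *ₙ L) X)))
shifts₀-strictly-decreasing {a} {X} L X-uni above-bottom n k ∑≢0
  with ∑<-nonzero (suc n) (λ t → shift 0ℤ (t *ₙ L) X (+ k) n) ∑≢0
... | t , _ , term≢0 with shift₀≢0⇒ (t *ₙ L) X (+ k) n term≢0
...   | tL≤n , X≢0 with above-bottom k (n ∸ t *ₙ L) X≢0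
...     | (T , n∸tL≡) , bottom-strict =
  ∑<-mono-< (suc n) (λ t _ → shift₀-mono (t *ₙ L) X n (λ n′ → IsUnimodal.decreasing (X-uni n′) k)) (t +ₙ T) t+T<1+n
    (subst₂ _<_ (sym (trans (shift₀-≤ ((t +ₙ T) *ₙ L) X (+ (k +ₙ a)) n t+T≤) (cong (X (+ (k +ₙ a))) n∸[t+T]L≡kL)))
                (sym (trans (shift₀-≤ ((t +ₙ T) *ₙ L) X (+ k) n t+T≤) (cong (X (+ k)) n∸[t+T]L≡kL)))
                bottom-strict)
  where
  regroup : ∀ t T k L → t *ₙ L +ₙ (T *ₙ L +ₙ k *ₙ L) ≡ (t +ₙ T) *ₙ L +ₙ k *ₙ L
  regroup = ℕ-Solver.solve-∀
  n≡ : n ≡ (t +ₙ T) *ₙ L +ₙ k *ₙ L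
  n≡ = trans (sym (ℕₚ.m+[n∸m]≡n tL≤n)) (trans (cong (t *ₙ L +ₙ_) n∸tL≡) (regroup t T k L))
  t+T≤ : (t +ₙ T) *ₙ L ≤ₙ n
  t+T≤ = subst ((t +ₙ T) *ₙ L ≤ₙ_) (sym n≡) (ℕₚ.m≤m+n _ _)
  n∸[t+T]L≡kL : n ∸ (t +ₙ T) *ₙ L ≡ k *ₙ L
  n∸[t+T]L≡kL = trans (cong (_∸ (t +ₙ T) *ₙ L) n≡) (ℕₚ.m+n∸m≡n ((t +ₙ T) *ₙ L) (k *ₙ L))
  t+T<1+n : t +ₙ T <ₙ suc n
  t+T<1+n = s≤s (ℕₚ.≤-trans (ℕₚ.m≤m*n (t +ₙ T) L) t+T≤)

record UnimodalSeries (a : ℕ) (X : Series) : Set where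
  field
    admissible : Admissible X
    unimodal   : ∀ n → IsUnimodal a ([q^ n ] X)

record StrictlyUnimodalSeries (a : ℕ) (X : Series) : Set where
  field
    unimodalSeries      : UnimodalSeries a X
    strictly-decreasing : ∀ n → StrictlyDecreasingBy a ([q^ n ] X)

module _ {a : ℕ} (a∈12 : a ≡ 1 ⊎ a ≡ 2) {X Y : Series} (X-uni : UnimodalSeries a X) (Y-uni : UnimodalSeries a Y) where
  private
    module X = UnimodalSeries X-uni
    module Y = UnimodalSeries Y-uni
    module Xₖ k = IsUnimodal (X.unimodal k)
    module Yₖ k = IsUnimodal (Y.unimodal k)

    module _ (n : ℕ) where
      level : ℕ → ℕ → ℤ → ℤ
      level N k = convolve N ([q^ k ] X) ([q^ (n ∸ k) ] Y)

      X≡0 : ∀ k → k <ₙ suc n → VanishesBeyond n ([q^ k ] X)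
      X≡0 k k<sn = VanishesBeyond-mono (ℕₚ.≤-pred k<sn) (X.admissible k)

      Y≡0 : ∀ k → VanishesBeyond n ([q^ (n ∸ k) ] Y)
      Y≡0 k = VanishesBeyond-mono (ℕₚ.m∸n≤m n k) (Y.admissible (n ∸ k))

      Nₖ : ℕ → ℕ
      Nₖ k = suc (n +ₙ (k +ₙ a))

      ⊛-coeffₖ : ∀ k m → (X ⊛ Y) m n ≡ ∑< (suc n) (λ i → level (Nₖ k) i m)
      ⊛-coeffₖ k m = ⊛-coeff X Y X.admissible m n (Nₖ k) (s≤s (ℕₚ.m≤m+n n (k +ₙ a)))

      level-decreasing : ∀ k i → i <ₙ suc n → level (Nₖ k) i (+ (k +ₙ a)) ≤ level (Nₖ k) i (+ k)
      level-decreasing k i i<sn = UnimodalConvolution.convolve-decreasing a∈12 (X≡0 i i<sn) (Y≡0 i) (X.unimodal i) (Y.unimodal (n ∸ i))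
                                                                          k (Nₖ k) ℕₚ.≤-refl

      ⊛-level-unimodal : IsUnimodal a ([q^ n ] (X ⊛ Y))
      ⊛-level-unimodal = record
        { symmetric  = λ m → trans (⊛-coeff X Y X.admissible (- m) n (suc n) ℕₚ.≤-refl)
                         (trans (∑<-cong-< (suc n) (λ i i<sn → convolve-symmetric n _ _ (X≡0 i i<sn) (Xₖ.symmetric i)
                                                                 (Yₖ.symmetric (n ∸ i)) (suc n) ℕₚ.≤-refl m))
                                (sym (⊛-coeff X Y X.admissible m n (suc n) ℕₚ.≤-refl)))
        ; nonneg     = λ m → subst (0ℤ ≤_) (sym (⊛-coeff X Y X.admissible m n (suc n) ℕₚ.≤-refl))
                         (∑<-nonneg (suc n) (λ i _ → convolve-nonneg _ _ (Xₖ.nonneg i) (Yₖ.nonneg (n ∸ i)) (suc n) m))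
        ; decreasing = λ k → subst₂ _≤_ (sym (⊛-coeffₖ k (+ (k +ₙ a)))) (sym (⊛-coeffₖ k (+ k)))
                         (∑<-mono-≤ (suc n) (level-decreasing k))
        }

      ⊛-level-strictly-decreasing : (∀ k → StrictlyDecreasingBy a ([q^ k ] X)) → (∀ k → StrictlyDecreasingBy a ([q^ k ] Y)) →
        StrictlyDecreasingBy a ([q^ n ] (X ⊛ Y))
      ⊛-level-strictly-decreasing X-strict Y-strict k coeff≢0 with ∑<-nonzero (suc n) (λ i → level (Nₖ k) i (+ k))
                                                                     (λ ∑≡0 → coeff≢0 (trans (⊛-coeffₖ k (+ k)) ∑≡0))
      ... | i , i<sn , level≢0 = subst₂ _<_ (sym (⊛-coeffₖ k (+ (k +ₙ a)))) (sym (⊛-coeffₖ k (+ k)))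
        (∑<-mono-< (suc n) (level-decreasing k) i i<sn
          (convolve-strictly-decreasing a∈12 (X≡0 i i<sn) (Y≡0 i) (X.unimodal i) (Y.unimodal (n ∸ i)) (X-strict i) (Y-strict (n ∸ i))
                                        k (Nₖ k) ℕₚ.≤-refl level≢0))

  ⊛-unimodal : UnimodalSeries a (X ⊛ Y)
  ⊛-unimodal = record { admissible = ⊛-admissible X Y X.admissible Y.admissible ; unimodal = ⊛-level-unimodal }

  ⊛-strictly-decreasing : (∀ n → StrictlyDecreasingBy a ([q^ n ] X)) → (∀ n → StrictlyDecreasingBy a ([q^ n ] Y)) →
    ∀ n → StrictlyDecreasingBy a ([q^ n ] (X ⊛ Y))
  ⊛-strictly-decreasing X-strict Y-strict n = ⊛-level-strictly-decreasing n X-strict Y-strict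

⊛-strictlyUnimodal : ∀ {a} → a ≡ 1 ⊎ a ≡ 2 → ∀ {X Y} → StrictlyUnimodalSeries a X → StrictlyUnimodalSeries a Y → StrictlyUnimodalSeries a (X ⊛ Y)
⊛-strictlyUnimodal a∈12 X-uni Y-uni = record
  { unimodalSeries      = ⊛-unimodal a∈12 (unimodalSeries X-uni) (unimodalSeries Y-uni)
  ; strictly-decreasing = ⊛-strictly-decreasing a∈12 (unimodalSeries X-uni) (unimodalSeries Y-uni)
                                                (strictly-decreasing X-uni) (strictly-decreasing Y-uni)
  }
  where open StrictlyUnimodalSeries

one-strictlyUnimodal : ∀ {a} → 1 ≤ₙ a → StrictlyUnimodalSeries a one
one-strictlyUnimodal {a} 1≤a = record
  { unimodalSeries      = record
    { admissible = δ-admissible 0ℤ 0 z≤n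
    ; unimodal   = λ n → record
      { symmetric  = λ m → 𝟙-cong ((- m ℤₚ.≟ 0ℤ) ×-dec (n ℕₚ.≟ 0)) ((m ℤₚ.≟ 0ℤ) ×-dec (n ℕₚ.≟ 0))
                             (λ { (-m≡0 , n≡0) → trans (sym (ℤₚ.neg-involutive m)) (cong -_ -m≡0) , n≡0 })
                             (λ { (m≡0 , n≡0) → cong -_ m≡0 , n≡0 })
      ; nonneg     = λ m → 𝟙-nonneg ((m ℤₚ.≟ 0ℤ) ×-dec (n ℕₚ.≟ 0))
      ; decreasing = λ k → subst (_≤ one (+ k) n) (sym (one[k+a]≡0 k n)) (𝟙-nonneg ((+ k ℤₚ.≟ 0ℤ) ×-dec (n ℕₚ.≟ 0)))
      }
    }
  ; strictly-decreasing = λ n k one≢0 → subst₂ _<_ (sym (one[k+a]≡0 k n))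
      (sym (𝟙-yes ((+ k ℤₚ.≟ 0ℤ) ×-dec (n ℕₚ.≟ 0)) (𝟙≢0⇒ ((+ k ℤₚ.≟ 0ℤ) ×-dec (n ℕₚ.≟ 0)) one≢0))) (ℤ.+<+ (s≤s z≤n))
  }
  where
  one[k+a]≡0 : ∀ k n → one (+ (k +ₙ a)) n ≡ 0ℤ
  one[k+a]≡0 k n = 𝟙-no ((+ (k +ₙ a) ℤₚ.≟ 0ℤ) ×-dec (n ℕₚ.≟ 0))
    (λ { (k+a≡0 , _) → ℕₚ.<⇒≱ (ℕₚ.≤-trans 1≤a (ℕₚ.m≤n+m a k)) (ℕₚ.≤-reflexive (ℤₚ.+-injective k+a≡0)) })

1≤a : ∀ {a} → a ≡ 1 ⊎ a ≡ 2 → 1 ≤ₙ a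
1≤a (inj₁ refl) = s≤s z≤n
1≤a (inj₂ refl) = s≤s z≤n

module _ {a : ℕ} (a∈12 : a ≡ 1 ⊎ a ≡ 2) where

  pow-unimodal : ∀ {F} → UnimodalSeries a F → ∀ k → UnimodalSeries a (pow F k)
  pow-unimodal F-uni zero    = StrictlyUnimodalSeries.unimodalSeries (one-strictlyUnimodal (1≤a a∈12))
  pow-unimodal F-uni (suc k) = ⊛-unimodal a∈12 (pow-unimodal F-uni k) F-uni

  pow-strictlyUnimodal : ∀ {F} → StrictlyUnimodalSeries a F → ∀ k → StrictlyUnimodalSeries a (pow F k)
  pow-strictlyUnimodal F-uni zero    = one-strictlyUnimodal (1≤a a∈12)
  pow-strictlyUnimodal F-uni (suc k) = ⊛-strictlyUnimodal a∈12 (pow-strictlyUnimodal F-uni k) F-uni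

  prodUpTo-unimodal : ∀ S F → (∀ ℓ → UnimodalSeries a (F ℓ)) → ∀ N → UnimodalSeries a (prodUpTo S F N)
  prodUpTo-unimodal S F F-uni zero    = StrictlyUnimodalSeries.unimodalSeries (one-strictlyUnimodal (1≤a a∈12))
  prodUpTo-unimodal S F F-uni (suc N) = ⊛-unimodal a∈12 (prodUpTo-unimodal S F F-uni N) (pow-unimodal (F-uni N) (S (suc N)))

  prodUpTo-strictlyUnimodal : ∀ S F → (∀ ℓ → StrictlyUnimodalSeries a (F ℓ)) → ∀ N → StrictlyUnimodalSeries a (prodUpTo S F N)
  prodUpTo-strictlyUnimodal S F F-uni zero    = one-strictlyUnimodal (1≤a a∈12)
  prodUpTo-strictlyUnimodal S F F-uni (suc N) =
    ⊛-strictlyUnimodal a∈12 (prodUpTo-strictlyUnimodal S F F-uni N) (pow-strictlyUnimodal (F-uni N) (S (suc N)))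

oneMinus-admissible : ∀ e d → ∣ e ∣ ≤ₙ d → Admissible (oneMinus e d)
oneMinus-admissible e d ∣e∣≤d n m n<∣m∣ = cong₂ _-_ (δ-admissible (+ 0) 0 z≤n n m n<∣m∣) (δ-admissible e d ∣e∣≤d n m n<∣m∣)

zNum-admissible : ∀ s b ℓ → ∣ s ∣ ≤ₙ 1 → 1 ≤ₙ ℓ → Admissible (zNum s b ℓ)
zNum-admissible s (fin b) ℓ ∣s∣≤1 1≤ℓ = oneMinus-admissible (+ suc b * s) (suc b *ₙ ℓ)
  (subst (_≤ₙ suc b *ₙ ℓ) (sym (ℤₚ.∣i*j∣≡∣i∣*∣j∣ (+ suc b) s)) (ℕₚ.*-monoʳ-≤ (suc b) (ℕₚ.≤-trans ∣s∣≤1 1≤ℓ)))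
zNum-admissible s ∞       ℓ _     _   = δ-admissible (+ 0) 0 z≤n

-- The number of terms of the truncated geometric sum (1 - (z^{±1}q^ℓ)^{b+1}) / (1 - z^{±1}q^ℓ) that
-- matter up to degree n; for b = ∞ the sum is infinite and n + 1 terms suffice.
termsUpTo : ℕ∞ → ℕ → ℕ
termsUpTo (fin b) n = suc b
termsUpTo ∞       n = suc n

module Factor (ℓ′ : ℕ) where
  open Geometric ℓ′ public

  W : ℕ → Series
  W B m n = ∑< B (λ i → ∑< B (λ j → δ (+ i - + j) ((i +ₙ j) *ₙ L) m n))

  closedP : ℕ → ℕ → Series
  closedP c B = ∑ˢ c (λ t → shift 0ℤ (t *ₙ L) (W B))

  closedR : ℕ → ℕ → ℕ → Series
  closedR c B n = ∑ˢ (suc n) (λ t → shift 0ℤ (t *ₙ L) (closedP c B))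

  private
    ∣te∣≤tL : ∀ t e → ∣ e ∣ ≤ₙ 1 → ∣ + t * e ∣ ≤ₙ t *ₙ L
    ∣te∣≤tL t e ∣e∣≤1 = subst (_≤ₙ t *ₙ L) (sym (ℤₚ.∣i*j∣≡∣i∣*∣j∣ (+ t) e)) (ℕₚ.*-monoʳ-≤ t (ℕₚ.≤-trans ∣e∣≤1 (s≤s z≤n)))

  geomSum-⊛ : ∀ e C X → ∣ e ∣ ≤ₙ 1 → (geomSum e C ⊛ X) ≈ ∑ˢ C (λ t → shift (+ t * e) (t *ₙ L) X)
  geomSum-⊛ e C X ∣e∣≤1 m n = trans (⊛-distribʳ-∑ˢ C (λ t → δ (+ t * e) (t *ₙ L)) X m n)
                                    (∑<-cong C (λ t → δ-⊛ (+ t * e) (t *ₙ L) X (∣te∣≤tL t e ∣e∣≤1) m n))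

  geomSum₀-⊛ : ∀ C X → (geomSum 0ℤ C ⊛ X) ≈ ∑ˢ C (λ t → shift 0ℤ (t *ₙ L) X)
  geomSum₀-⊛ C X m n = trans (geomSum-⊛ 0ℤ C X z≤n m n) (∑<-cong C (λ t → cong (λ e → shift e (t *ₙ L) X m n) (ℤₚ.*-zeroʳ (+ t))))

  geomSum-⊛-geomSum⁻ : ∀ B → (geomSum 1ℤ B ⊛ geomSum (- 1ℤ) B) ≈ W B
  geomSum-⊛-geomSum⁻ B m n = trans (geomSum-⊛ 1ℤ B (geomSum (- 1ℤ) B) ℕₚ.≤-refl m n)
    (∑<-cong B (λ i → trans (shift-∑ˢ (+ i * 1ℤ) (i *ₙ L) B (λ j → δ (+ j * - 1ℤ) (j *ₙ L)) m n)
      (∑<-cong B (λ j → trans (shift-δ (+ i * 1ℤ) (i *ₙ L) (+ j * - 1ℤ) (j *ₙ L) m n)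
        (cong₂ (λ e d → δ e d m n) (cong₂ _+_ (ℤₚ.*-identityʳ (+ i)) (trans (ℤₚ.*-comm (+ j) (- 1ℤ)) (ℤₚ.-1*i≡-i (+ j))))
                                   (sym (ℕₚ.*-distribʳ-+ L i j)))))))

  zNum-⊛-geomInv : ∀ s b n → ∣ s ∣ ≡ 1 → (zNum s b L ⊛ geomInv s ℓ′) ≈[ n ] geomSum s (termsUpTo b n)
  zNum-⊛-geomInv s (fin b) n ∣s∣≡1 = ≈⇒≈[] n (oneMinus-⊛-geomInv s (suc b) (ℕₚ.≤-reflexive ∣s∣≡1) refl)
  zNum-⊛-geomInv s ∞       n _     = ≈[]-trans n (≈⇒≈[] n (one-⊛ (geomInv s ℓ′))) (geomInv-truncate s n)

  factorP-admissible : ∀ a b → Admissible (factorP a b ℓ′)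
  factorP-admissible a b =
    ⊛-admissible _ _ (⊛-admissible _ _ (⊛-admissible _ _ (⊛-admissible _ _
      (⊛-admissible _ _ (oneMinus-admissible 0ℤ ((3 ∸ a) *ₙ L) z≤n) (zNum-admissible 1ℤ b L ℕₚ.≤-refl (s≤s z≤n)))
      (zNum-admissible (- 1ℤ) b L ℕₚ.≤-refl (s≤s z≤n)))
      (geomInv-admissible 0ℤ z≤n)) (geomInv-admissible 1ℤ ℕₚ.≤-refl)) (geomInv-admissible (- 1ℤ) ℕₚ.≤-refl)

  factorP≈closedP : ∀ a b n → factorP a b ℓ′ ≈[ n ] closedP (3 ∸ a) (termsUpTo b n)
  factorP≈closedP a b n = ≈[]-trans n (≈⇒≈[] n regroup)
    (≈[]-trans n (⊛-cong-≤ n (≈⇒≈[] n (oneMinus-⊛-geomInv 0ℤ c z≤n (sym (ℤₚ.*-zeroʳ (+ c)))))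
                             (⊛-cong-≤ n (zNum-⊛-geomInv 1ℤ b n refl) (zNum-⊛-geomInv (- 1ℤ) b n refl)))
                 (≈⇒≈[] n (≈-trans (⊛-cong {geomSum 0ℤ c} (λ _ _ → refl) (geomSum-⊛-geomSum⁻ T)) (geomSum₀-⊛ c (W T)))))
    where
    c = 3 ∸ a
    T = termsUpTo b n
    regroup = ⊛-pair-up (oneMinus 0ℤ (c *ₙ L)) (zNum 1ℤ b L) (zNum (- 1ℤ) b L) (geomInv 0ℤ ℓ′) (geomInv 1ℤ ℓ′) (geomInv (- 1ℤ) ℓ′)
      (oneMinus-admissible 0ℤ (c *ₙ L) z≤n) (zNum-admissible 1ℤ b L ℕₚ.≤-refl (s≤s z≤n)) (zNum-admissible (- 1ℤ) b L ℕₚ.≤-refl (s≤s z≤n))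
      (geomInv-admissible 0ℤ z≤n) (geomInv-admissible 1ℤ ℕₚ.≤-refl) (geomInv-admissible (- 1ℤ) ℕₚ.≤-refl)

  factorR≈closedR : ∀ a b n → factorR a b ℓ′ ≈[ n ] closedR (3 ∸ a) (termsUpTo b n) n
  factorR≈closedR a b n =
    ≈[]-trans n (≈⇒≈[] n (⊛-comm (factorP a b ℓ′) (geomInv 0ℤ ℓ′) (factorP-admissible a b) (geomInv-admissible 0ℤ z≤n)))
    (≈[]-trans n (⊛-cong-≤ n (geomInv-truncate 0ℤ n) (factorP≈closedP a b n))
                 (≈⇒≈[] n (geomSum₀-⊛ (suc n) (closedP (3 ∸ a) (termsUpTo b n)))))

  W-nonneg : ∀ B m n → 0ℤ ≤ W B m n
  W-nonneg B m n = ∑<-nonneg B (λ i _ → ∑<-nonneg B (λ j _ → 𝟙-nonneg ((m ℤₚ.≟ + i - + j) ×-dec (n ℕₚ.≟ (i +ₙ j) *ₙ L))))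

  W-symmetric : ∀ B m n → W B (- m) n ≡ W B m n
  W-symmetric B m n = trans (∑<-comm B B (λ i j → δ (+ i - + j) ((i +ₙ j) *ₙ L) (- m) n))
    (∑<-cong B (λ j → ∑<-cong B (λ i →
      𝟙-cong ((- m ℤₚ.≟ + i - + j) ×-dec (n ℕₚ.≟ (i +ₙ j) *ₙ L)) ((m ℤₚ.≟ + j - + i) ×-dec (n ℕₚ.≟ (j +ₙ i) *ₙ L))
        (λ { (-m≡i-j , n≡) → trans (sym (ℤₚ.neg-involutive m)) (trans (cong -_ -m≡i-j) (-[x-y]≡y-x (+ i) (+ j))) ,
                             trans n≡ (cong (_*ₙ L) (ℕₚ.+-comm i j)) })
        (λ { (m≡j-i , n≡) → trans (cong -_ m≡j-i) (-[x-y]≡y-x (+ j) (+ i)) , trans n≡ (cong (_*ₙ L) (ℕₚ.+-comm j i)) }))))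
    where
    -[x-y]≡y-x : ∀ x y → - (x - y) ≡ y - x
    -[x-y]≡y-x = solve-∀

  -- z^k q^n (k ≥ 0) occurs in W B as (z q^L)^(k+j) (z⁻¹ q^L)^j.
  record Witness (B k n : ℕ) : Set where
    constructor witness
    field
      j      : ℕ
      k+j<B  : k +ₙ j <ₙ B
      n≡     : n ≡ (k +ₙ j +ₙ j) *ₙ L

  private
    +k≡+i-+j⇒i≡k+j : ∀ {k i j} → + k ≡ + i - + j → i ≡ k +ₙ j
    +k≡+i-+j⇒i≡k+j {k} {i} {j} eq = ℤₚ.+-injective (begin
      + i            ≡⟨ x-y+y≡x (+ i) (+ j) ⟨
      + i - + j + + j ≡⟨ cong (_+ + j) eq ⟨
      + k + + j      ∎)
      where
      open ≡-Reasoning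
      x-y+y≡x : ∀ x y → x - y + y ≡ x
      x-y+y≡x = solve-∀

    j+j-injective : ∀ {j j′} → j +ₙ j ≡ j′ +ₙ j′ → j ≡ j′
    j+j-injective {j} {j′} eq with ℕₚ.<-cmp j j′
    ... | tri< j<j′ _ _ = ⊥-elim (ℕₚ.<-irrefl eq (ℕₚ.+-mono-< j<j′ j<j′))
    ... | tri≈ _ j≡j′ _ = j≡j′
    ... | tri> _ _ j>j′ = ⊥-elim (ℕₚ.<-irrefl (sym eq) (ℕₚ.+-mono-< j>j′ j>j′))

    term-position : ∀ {k i j′ j} → + k ≡ + i - + j′ → (i +ₙ j′) *ₙ L ≡ (k +ₙ j +ₙ j) *ₙ L → i ≡ k +ₙ j × j′ ≡ j
    term-position {k} {i} {j′} {j} k≡i-j′ degrees = trans i≡k+j′ (cong (k +ₙ_) j′≡j) , j′≡j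
      where
      i≡k+j′ = +k≡+i-+j⇒i≡k+j k≡i-j′
      j′≡j = j+j-injective (ℕₚ.+-cancelˡ-≡ k _ _ (begin
        k +ₙ (j′ +ₙ j′)    ≡⟨ ℕₚ.+-assoc k j′ j′ ⟨
        k +ₙ j′ +ₙ j′      ≡⟨ cong (_+ₙ j′) i≡k+j′ ⟨
        i +ₙ j′            ≡⟨ ℕₚ.*-cancelʳ-≡ (i +ₙ j′) (k +ₙ j +ₙ j) L degrees ⟩
        k +ₙ j +ₙ j        ≡⟨ ℕₚ.+-assoc k j j ⟩
        k +ₙ (j +ₙ j)      ∎))
        where open ≡-Reasoning

  W-witness : ∀ {B k n} → Witness B k n → W B (+ k) n ≡ 1ℤ
  W-witness {B} {k} {n} (witness j k+j<B refl) =
    trans (∑<-single B (k +ₙ j) row k+j<B other-row≡0)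
          (trans (∑<-single B j (term (k +ₙ j)) (ℕₚ.≤-<-trans (ℕₚ.m≤n+m j k) k+j<B) other-term≡0)
                 (𝟙-yes ((+ k ℤₚ.≟ + (k +ₙ j) - + j) ×-dec (n′ ℕₚ.≟ n′)) (sym (+[a+b]-b≡a k j) , refl)))
    where
    n′ = (k +ₙ j +ₙ j) *ₙ L
    term : ℕ → ℕ → ℤ
    term i j′ = δ (+ i - + j′) ((i +ₙ j′) *ₙ L) (+ k) n′
    row : ℕ → ℤ
    row i = ∑< B (term i)
    term≢0⇒ : ∀ i j′ → term i j′ ≢ 0ℤ → i ≡ k +ₙ j × j′ ≡ j
    term≢0⇒ i j′ t≢0 = let (k≡i-j′ , degrees) = 𝟙≢0⇒ ((+ k ℤₚ.≟ + i - + j′) ×-dec (n′ ℕₚ.≟ (i +ₙ j′) *ₙ L)) t≢0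
                       in term-position k≡i-j′ (sym degrees)
    term≡0 : ∀ i j′ → ¬ (i ≡ k +ₙ j × j′ ≡ j) → term i j′ ≡ 0ℤ
    term≡0 i j′ off with term i j′ ℤₚ.≟ 0ℤ
    ... | yes t≡0 = t≡0
    ... | no  t≢0 = ⊥-elim (off (term≢0⇒ i j′ t≢0))
    other-row≡0 : ∀ i → i ≢ k +ₙ j → row i ≡ 0ℤ
    other-row≡0 i i≢k+j = ∑<-zero B (λ j′ _ → term≡0 i j′ (i≢k+j ∘ proj₁))
    other-term≡0 : ∀ j′ → j′ ≢ j → term (k +ₙ j) j′ ≡ 0ℤ
    other-term≡0 j′ j′≢j = term≡0 (k +ₙ j) j′ (j′≢j ∘ proj₂)

  W≢0⇒witness : ∀ {B k n} → W B (+ k) n ≢ 0ℤ → Witness B k n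
  W≢0⇒witness {B} {k} {n} W≢0 with ∑<-nonzero B _ W≢0
  ... | i , i<B , row≢0 with ∑<-nonzero B _ row≢0
  ...   | j , _ , term≢0 with 𝟙≢0⇒ ((+ k ℤₚ.≟ + i - + j) ×-dec (n ℕₚ.≟ (i +ₙ j) *ₙ L)) term≢0
  ...     | k≡i-j , n≡ = witness j (subst (_<ₙ B) i≡k+j i<B) (trans n≡ (cong (λ i → (i +ₙ j) *ₙ L) i≡k+j))
    where i≡k+j = +k≡+i-+j⇒i≡k+j k≡i-j

  W-mono : ∀ {B k n k′ n′} → (Witness B k n → Witness B k′ n′) → W B (+ k) n ≤ W B (+ k′) n′
  W-mono {B} {k} {n} {k′} {n′} move with W B (+ k) n ℤₚ.≟ 0ℤ
  ... | yes W≡0 = subst (_≤ W B (+ k′) n′) (sym W≡0) (W-nonneg B (+ k′) n′)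
  ... | no  W≢0 = ℤₚ.≤-reflexive (trans (W-witness w) (sym (W-witness (move w))))
    where w = W≢0⇒witness W≢0

  witness-lower₂ : ∀ {B k n} → Witness B (k +ₙ 2) n → Witness B k n
  witness-lower₂ {B} {k} (witness j k+2+j<B n≡) =
    witness (suc j) (ℕₚ.<-trans (ℕₚ.≤-reflexive (sym (regroup₁ k j))) k+2+j<B) (trans n≡ (cong (_*ₙ L) (regroup₂ k j)))
    where
    regroup₁ : ∀ k j → k +ₙ 2 +ₙ j ≡ suc (k +ₙ suc j)
    regroup₁ = ℕ-Solver.solve-∀
    regroup₂ : ∀ k j → k +ₙ 2 +ₙ j +ₙ j ≡ k +ₙ suc j +ₙ suc j
    regroup₂ = ℕ-Solver.solve-∀

  witness-lower₁ : ∀ {B k n} → Witness B (k +ₙ 1) n → L ≤ₙ n × Witness B k (n ∸ L)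
  witness-lower₁ {B} {k} {n} (witness j k+1+j<B n≡) =
    subst (L ≤ₙ_) (sym n≡L+) (ℕₚ.m≤m+n L _) ,
    witness j (ℕₚ.≤-<-trans (ℕₚ.+-monoˡ-≤ j (ℕₚ.m≤m+n k 1)) k+1+j<B) (trans (cong (_∸ L) n≡L+) (ℕₚ.m+n∸m≡n L _))
    where
    regroup : ∀ k j L → (k +ₙ 1 +ₙ j +ₙ j) *ₙ L ≡ L +ₙ (k +ₙ j +ₙ j) *ₙ L
    regroup = ℕ-Solver.solve-∀
    n≡L+ : n ≡ L +ₙ (k +ₙ j +ₙ j) *ₙ L
    n≡L+ = trans n≡ (regroup k j L)

  witness-raise₁ : ∀ {B k n} → Witness B (k +ₙ 1) n → Witness B k (n +ₙ L)
  witness-raise₁ {B} {k} {n} (witness j k+1+j<B n≡) =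
    witness (suc j) (subst (_<ₙ B) (regroup₁ k j) k+1+j<B) (trans (cong (_+ₙ L) n≡) (regroup₂ k j L))
    where
    regroup₁ : ∀ k j → k +ₙ 1 +ₙ j ≡ k +ₙ suc j
    regroup₁ = ℕ-Solver.solve-∀
    regroup₂ : ∀ k j L → (k +ₙ 1 +ₙ j +ₙ j) *ₙ L +ₙ L ≡ (k +ₙ suc j +ₙ suc j) *ₙ L
    regroup₂ = ℕ-Solver.solve-∀

  witness-bottom : ∀ {B k n} → Witness B k n → Witness B k (k *ₙ L) × ∃ λ s → n ≡ s *ₙ L +ₙ k *ₙ L
  witness-bottom {B} {k} {n} (witness j k+j<B n≡) =
    witness 0 (ℕₚ.≤-<-trans (ℕₚ.≤-reflexive (ℕₚ.+-identityʳ k)) (ℕₚ.≤-<-trans (ℕₚ.m≤m+n k j) k+j<B))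
              (cong (_*ₙ L) (sym (trans (ℕₚ.+-identityʳ (k +ₙ 0)) (ℕₚ.+-identityʳ k)))) ,
    j +ₙ j , trans n≡ (regroup k j L)
    where
    regroup : ∀ k j L → (k +ₙ j +ₙ j) *ₙ L ≡ (j +ₙ j) *ₙ L +ₙ k *ₙ L
    regroup = ℕ-Solver.solve-∀

  witness-degree : ∀ {B k n} → Witness B k n → k *ₙ L ≤ₙ n
  witness-degree {k = k} (witness j _ refl) = ℕₚ.*-monoˡ-≤ L (ℕₚ.≤-trans (ℕₚ.m≤m+n k j) (ℕₚ.m≤m+n (k +ₙ j) j))

  W-unimodal : ∀ B n → IsUnimodal 2 ([q^ n ] (W B))
  W-unimodal B n = record
    { symmetric  = λ m → W-symmetric B m n
    ; nonneg     = λ m → W-nonneg B m n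
    ; decreasing = λ k → W-mono {B} {k +ₙ 2} {n} {k} {n} witness-lower₂
    }

  closedP-unimodal₂ : ∀ c B n → IsUnimodal 2 ([q^ n ] (closedP c B))
  closedP-unimodal₂ c B = shifts₀-unimodal (W-unimodal B) c (_*ₙ L)

  private
    W[k+1]≤shift : ∀ B k n → W B (+ (k +ₙ 1)) n ≤ shift 0ℤ L (W B) (+ k) n
    W[k+1]≤shift B k n with W B (+ (k +ₙ 1)) n ℤₚ.≟ 0ℤ
    ... | yes W≡0 = subst (_≤ shift 0ℤ L (W B) (+ k) n) (sym W≡0)
                          (*-nonneg (𝟙-nonneg (L ℕₚ.≤? n)) (W-nonneg B (+ k - 0ℤ) (n ∸ L)))
    ... | no  W≢0 with W≢0⇒witness {B} {k +ₙ 1} {n} W≢0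
    ...   | w with witness-lower₁ w
    ...     | L≤n , w′ = ℤₚ.≤-reflexive (trans (W-witness w) (sym (trans (shift₀-≤ L (W B) (+ k) n L≤n) (W-witness w′))))

    shift[k+1]≤W : ∀ B k n → shift 0ℤ L (W B) (+ (k +ₙ 1)) n ≤ W B (+ k) n
    shift[k+1]≤W B k n with L ℕₚ.≤? n
    ... | yes L≤n = subst (_≤ W B (+ k) n) (sym (shift₀-≤ L (W B) (+ (k +ₙ 1)) n L≤n))
                          (W-mono {B} {k +ₙ 1} {n ∸ L} {k} {n} (subst (Witness B k) (ℕₚ.m∸n+n≡m L≤n) ∘ witness-raise₁))
    ... | no  L≰n = subst (_≤ W B (+ k) n) (sym (shift-≰ 0ℤ L (W B) (+ (k +ₙ 1)) n L≰n)) (W-nonneg B (+ k) n)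

    closedP₂ : ∀ B m n → closedP 2 B m n ≡ W B m n + shift 0ℤ L (W B) m n
    closedP₂ B m n = cong₂ _+_ (trans (ℤₚ.+-identityˡ (shift 0ℤ 0 (W B) m n)) (shift₀-≤ 0 (W B) m n z≤n))
                               (cong (λ d → shift 0ℤ d (W B) m n) (ℕₚ.*-identityˡ L))

  closedP-decreasing₁ : ∀ B n → DecreasingBy 1 ([q^ n ] (closedP 2 B))
  closedP-decreasing₁ B n k = subst₂ _≤_ (sym (closedP₂ B (+ (k +ₙ 1)) n)) (sym (closedP₂ B (+ k) n))
    (subst (W B (+ (k +ₙ 1)) n + shift 0ℤ L (W B) (+ (k +ₙ 1)) n ≤_) (ℤₚ.+-comm (shift 0ℤ L (W B) (+ k) n) (W B (+ k) n))
           (ℤₚ.+-mono-≤ (W[k+1]≤shift B k n) (shift[k+1]≤W B k n)))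

  closedP-unimodal : ∀ {a} → a ≡ 1 ⊎ a ≡ 2 → ∀ B n → IsUnimodal a ([q^ n ] (closedP (3 ∸ a) B))
  closedP-unimodal (inj₂ refl) B n = closedP-unimodal₂ 1 B n
  closedP-unimodal (inj₁ refl) B n = record
    { symmetric  = IsUnimodal.symmetric (closedP-unimodal₂ 2 B n)
    ; nonneg     = IsUnimodal.nonneg (closedP-unimodal₂ 2 B n)
    ; decreasing = closedP-decreasing₁ B n
    }

  W-vanishes-below : ∀ B k n → n <ₙ k *ₙ L → W B (+ k) n ≡ 0ℤ
  W-vanishes-below B k n n<kL with W B (+ k) n ℤₚ.≟ 0ℤ
  ... | yes W≡0 = W≡0
  ... | no  W≢0 = ⊥-elim (ℕₚ.<⇒≱ n<kL (witness-degree (W≢0⇒witness {B} {k} {n} W≢0)))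

  closedP-vanishes-below : ∀ c B k n → n <ₙ k *ₙ L → closedP c B (+ k) n ≡ 0ℤ
  closedP-vanishes-below c B k n n<kL = ∑<-zero c (λ t _ → term≡0 t (t *ₙ L ℕₚ.≤? n))
    where
    term≡0 : ∀ t → Dec (t *ₙ L ≤ₙ n) → shift 0ℤ (t *ₙ L) (W B) (+ k) n ≡ 0ℤ
    term≡0 t (yes tL≤n) = trans (shift₀-≤ (t *ₙ L) (W B) (+ k) n tL≤n)
                                (W-vanishes-below B k (n ∸ t *ₙ L) (ℕₚ.≤-<-trans (ℕₚ.m∸n≤m n (t *ₙ L)) n<kL))
    term≡0 t (no tL≰n)  = shift-≰ 0ℤ (t *ₙ L) (W B) (+ k) n tL≰n

  closedP≢0⇒witness : ∀ c B k n → closedP c B (+ k) n ≢ 0ℤ → ∃ λ t → t *ₙ L ≤ₙ n × Witness B k (n ∸ t *ₙ L)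
  closedP≢0⇒witness c B k n closedP≢0 with ∑<-nonzero c (λ t → shift 0ℤ (t *ₙ L) (W B) (+ k) n) closedP≢0
  ... | t , _ , term≢0 with shift₀≢0⇒ (t *ₙ L) (W B) (+ k) n term≢0
  ...   | tL≤n , W≢0 = t , tL≤n , W≢0⇒witness W≢0

  closedP-witness : ∀ c B k n → 1 ≤ₙ c → Witness B k n → 1ℤ ≤ closedP c B (+ k) n
  closedP-witness c B k n 1≤c w = ℤₚ.≤-trans (ℤₚ.≤-reflexive (sym (trans (shift₀-≤ 0 (W B) (+ k) n z≤n) (W-witness w))))
                                             (term≤∑< c (λ t _ → term-nonneg t) 0 1≤c)
    where
    term-nonneg : ∀ t → 0ℤ ≤ shift 0ℤ (t *ₙ L) (W B) (+ k) n
    term-nonneg t = *-nonneg (𝟙-nonneg (t *ₙ L ℕₚ.≤? n)) (W-nonneg B (+ k - 0ℤ) (n ∸ t *ₙ L))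

  closedP-above-bottom : ∀ {a} c B → 1 ≤ₙ a → 1 ≤ₙ c → ∀ k n → closedP c B (+ k) n ≢ 0ℤ →
    (∃ λ T → n ≡ T *ₙ L +ₙ k *ₙ L) × closedP c B (+ (k +ₙ a)) (k *ₙ L) < closedP c B (+ k) (k *ₙ L)
  closedP-above-bottom {a} c B 1≤a 1≤c k n closedP≢0 = from-witness (closedP≢0⇒witness c B k n closedP≢0)
    where
    closedP[k+a]<1 : closedP c B (+ (k +ₙ a)) (k *ₙ L) < 1ℤ
    closedP[k+a]<1 = subst (_< 1ℤ) (sym (closedP-vanishes-below c B (k +ₙ a) (k *ₙ L) (ℕₚ.*-monoˡ-< L (ℕₚ.m<m+n k 1≤a))))
                           (ℤ.+<+ (s≤s z≤n))
    regroup : ∀ t s k L → t *ₙ L +ₙ (s *ₙ L +ₙ k *ₙ L) ≡ (t +ₙ s) *ₙ L +ₙ k *ₙ L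
    regroup = ℕ-Solver.solve-∀
    from-witness : (∃ λ t → t *ₙ L ≤ₙ n × Witness B k (n ∸ t *ₙ L)) →
      (∃ λ T → n ≡ T *ₙ L +ₙ k *ₙ L) × closedP c B (+ (k +ₙ a)) (k *ₙ L) < closedP c B (+ k) (k *ₙ L)
    from-witness (t , tL≤n , w) =
      let (bottom , s , n∸tL≡) = witness-bottom w
      in (t +ₙ s , trans (sym (ℕₚ.m+[n∸m]≡n tL≤n)) (trans (cong (t *ₙ L +ₙ_) n∸tL≡) (regroup t s k L))) ,
         ℤₚ.<-≤-trans closedP[k+a]<1 (closedP-witness c B k (k *ₙ L) 1≤c bottom)

  factorP-unimodal : ∀ {a} → a ≡ 1 ⊎ a ≡ 2 → ∀ b → UnimodalSeries a (factorP a b ℓ′)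
  factorP-unimodal {a} a∈12 b = record
    { admissible = factorP-admissible a b
    ; unimodal   = λ n → IsUnimodal-≗ (λ m → factorP≈closedP a b n m n ℕₚ.≤-refl) (closedP-unimodal a∈12 (termsUpTo b n) n)
    }

  factorR-strictlyUnimodal : ∀ {a} → a ≡ 1 ⊎ a ≡ 2 → ∀ b → StrictlyUnimodalSeries a (factorR a b ℓ′)
  factorR-strictlyUnimodal {a} a∈12 b = record
    { unimodalSeries      = record
      { admissible = ⊛-admissible (factorP a b ℓ′) (geomInv 0ℤ ℓ′) (factorP-admissible a b) (geomInv-admissible 0ℤ z≤n)
      ; unimodal   = λ n → IsUnimodal-≗ (factorR≈closedR′ n) (shifts₀-unimodal (closedP-unimodal a∈12 (termsUpTo b n)) (suc n) (_*ₙ L) n)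
      }
    ; strictly-decreasing = λ n → StrictlyDecreasingBy-≗ (factorR≈closedR′ n)
        (shifts₀-strictly-decreasing L (closedP-unimodal a∈12 (termsUpTo b n))
                                     (closedP-above-bottom (3 ∸ a) (termsUpTo b n) (1≤a a∈12) (1≤3∸a a∈12)) n)
    }
    where
    factorR≈closedR′ : ∀ n m → factorR a b ℓ′ m n ≡ closedR (3 ∸ a) (termsUpTo b n) n m n
    factorR≈closedR′ n m = factorR≈closedR a b n m n ℕₚ.≤-refl
    1≤3∸a : ∀ {a} → a ≡ 1 ⊎ a ≡ 2 → 1 ≤ₙ 3 ∸ a
    1≤3∸a (inj₁ refl) = s≤s z≤n
    1≤3∸a (inj₂ refl) = s≤s z≤n

theorem3p5 : (S : Multiset⁺) (b : ℕ∞) (a : ℕ) → (a ≡ 1 ⊎ a ≡ 2) →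
    (m n : ℕ) →
      (p a b S (+ m + + a) n ≤ p a b S (+ m) n)
      × (r a b S (+ m) n ≢ + 0 → r a b S (+ m + + a) n < r a b S (+ m) n)
theorem3p5 S b a a∈12 m n = p-decreasing m , r-strictly-decreasing m
  where
  p-unimodal = prodUpTo-unimodal a∈12 S (factorP a b) (λ ℓ′ → Factor.factorP-unimodal ℓ′ a∈12 b) n
  r-unimodal = prodUpTo-strictlyUnimodal a∈12 S (factorR a b) (λ ℓ′ → Factor.factorR-strictlyUnimodal ℓ′ a∈12 b) n
  p-decreasing = IsUnimodal.decreasing (UnimodalSeries.unimodal p-unimodal n)
  r-strictly-decreasing = StrictlyUnimodalSeries.strictly-decreasing r-unimodal n
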